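{- For every integer $m \ge 1$, with $J$, $K$, $N$ and the counting notation $\left|\begin{matrix}A&B\\ C&D\end{matrix}\right|_m$ as defined in the context, we have, modulo 2, $$ \left|\begin{matrix}J&J\\ J&J\end{matrix}\right|_m \equiv 1,\qquad \left|\begin{matrix}J&N\\ J&N\end{matrix}\right|_m \equiv 1,\qquad \left|\begin{matrix}J&N\\ N&N\end{matrix}\right|_m \equiv m, $$ $$ \left|\begin{matrix}K&K\\ K&K\end{matrix}\right|_m \equiv m+1,\qquad \left|\begin{matrix}K&N\\ K&K\end{matrix}\right|_m \equiv m+1,\qquad \left|\begin{matrix}K&N\\ N&K\end{matrix}\right|_m \equiv m+1. $$
   Context: Let $N$ denote the set of non-negative integers. Let $J=\{(2n+1)2^{2k}-1 \mid n,k\in N\}=\{0,2,3,4,6,8,10,11,\ldots\}$ and $K=N\setminus J=\{(2n+1)2^{2k+1}-1\mid n,k\in N\}=\{1,5,7,9,13,17,\ldots\}$. Let $\mathrm{Sym}_m$ be the set of all permutations of $\{0,1,\ldots,m-1\}$. For subsets $A,B,C,D$ of $N$, $\left|\begin{matrix}A&B\\ C&D\end{matrix}\right|_m$ denotes the number of permutations $\sigma\in\mathrm{Sym}_m$ such that $i+\sigma(i)\in A$ if $i,\sigma(i)\in[0,m-2]$; $i+\sigma(i)\in B$ if $i\in[0,m-2]$ and $\sigma(i)=m-1$; $i+\sigma(i)\in C$ if $i=m-1$ and $\sigma(i)\in[0,m-2]$; $i+\sigma(i)\in D$ if $i=\sigma(i)=m-1$. The notation $a\equiv b$ means congruence modulo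 2. -}

module Defs where

open import Data.Nat using (ℕ; zero; suc; _+_; _*_; _∸_; _^_; _%_)
open import Data.Fin using (Fin; toℕ)
open import Data.Vec using (Vec; []; _∷_; lookup; toList)
open import Data.List using (List; []; _∷_; [_]; map; concatMap; allFin)
open import Data.List.Relation.Unary.Unique.Propositional using (Unique)
open import Data.Product using (∃; ∃₂; _×_; _,_)
open import Data.Unit using (⊤)
open import Relation.Nullary using (¬_; yes; no)
open import Relation.Binary.PropositionalEquality using (_≡_)
import Data.Nat as ℕ

SubsetN : Set₁
SubsetN = ℕ → Set

Nset : SubsetN
Nset _ = ⊤

Jset : SubsetN
Jset x = ∃₂ λ n k → x ≡ (2 * n + 1) * 2 ^ (2 * k) ∸ 1

Kset : SubsetN
Kset x = ¬ Jset x

allVecs : (m k : ℕ) → List (Vec (Fin m) k)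
allVecs m zero    = [ [] ]
allVecs m (suc k) = concatMap (λ x → map (x ∷_) (allVecs m k)) (allFin m)

-- A vector σ : Vec (Fin m) m represents the map i ↦ lookup σ i;
-- it is a permutation of {0,…,m-1} iff its entries are pairwise distinct.
IsPerm : {m : ℕ} → Vec (Fin m) m → Set
IsPerm σ = Unique (toList σ)

region : (m : ℕ) (A B C D : SubsetN) → Fin m → Fin m → SubsetN
region m A B C D i j with toℕ i ℕ.≟ m ∸ 1 | toℕ j ℕ.≟ m ∸ 1
... | no  _ | no  _ = A
... | no  _ | yes _ = B
... | yes _ | no  _ = C
... | yes _ | yes _ = D

Admissible : (m : ℕ) (A B C D : SubsetN) → Vec (Fin m) m → Set
Admissible m A B C D σ =
  IsPerm σ × (∀ (i : Fin m) → region m A B C D i (lookup σ i) (toℕ i + toℕ (lookup σ i)))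

data CountIs {X : Set} (P : X → Set) : List X → ℕ → Set where
  c-nil  : CountIs P [] 0
  c-yes  : ∀ {x xs c} → P x   → CountIs P xs c → CountIs P (x ∷ xs) (suc c)
  c-no   : ∀ {x xs c} → ¬ P x → CountIs P xs c → CountIs P (x ∷ xs) c

PermCount : (m : ℕ) (A B C D : SubsetN) → ℕ → Set
PermCount m A B C D c = CountIs (Admissible m A B C D) (allVecs m m) c

_≡₂_ : ℕ → ℕ → Set
a ≡₂ b = a % 2 ≡ b % 2

CountParity : (m : ℕ) (A B C D : SubsetN) → ℕ → Set
CountParity m A B C D r = ∃ λ c → PermCount m A B C D c × c ≡₂ r

-- Counting permutations modulo 2 is computing a permanent over 𝔽₂, which is a determinant there:
-- it is linear in each row and vanishes when two rows are equal. Each matrix of the statement is a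
-- Hankel matrix [h (i + j)], h the indicator of J or K, with its last row and/or column changed.
-- Since J contains every even number and 2a + 1 ∈ J iff a ∉ J, K consists of odd numbers and
-- K (2a + (2b + 1)) = J (a + b). Ordering the indices by parity thus splits the K-Hankel matrix into
-- two J-Hankel blocks of half size, while a J-row is the all-ones row plus a K-row. Expanding in these
-- rows gives, for the J-Hankel permanents H n and the sums S n of the maximal minors of the
-- (n + 1) × n J-Hankel matrix, H (2p) = H p, H (2p + 1) = S p, S (2p) = S p · H p and
-- S (2p + 1) = S p · H (p + 1). Hence all of them are 1, and the K-Hankel permanent of size m is 1
-- iff m is even. The matrices with a changed border reduce to these values by expanding along it.

module Submission where

open import Defs
open import Algebra.Bundles using (CommutativeRing)
open import Algebra.Properties.CommutativeSemigroup using (interchange; x∙yz≈y∙xz)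
open import Data.Bool using (Bool; true; false; not; _∧_; _xor_; if_then_else_; T?)
open import Data.Bool.Properties
  using (xor-assoc; xor-comm; xor-same; xor-identityʳ; xor-∧-commutativeRing; ∧-distribˡ-xor; ∧-distribʳ-xor;
         ∧-comm; ∧-assoc; ∧-zeroʳ; ∧-idem; not-involutive; not-injective)
open import Data.Fin using (Fin; toℕ)
import Data.Fin as Fin
open import Data.List using (List; []; _∷_; _++_; [_]; map; length; concat; concatMap; filterᵇ; upTo; applyUpTo; allFin)
import Data.List as List
open import Data.List.Properties
  using (++-assoc; ++-identityʳ; map-++; filter-++; upTo-∷ʳ; length-map; length-++; length-upTo; map-tabulate; length-tabulate)
open import Data.List.Membership.Propositional using (_∈_)
open import Data.List.Membership.Propositional.Properties using (∈-allFin)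
open import Data.List.Relation.Binary.Permutation.Propositional as ↭ using (_↭_)
open import Data.List.Relation.Binary.Permutation.Propositional.Properties using (shift) renaming (map⁺ to ↭-map⁺)
open import Data.List.Relation.Unary.All as All using (All; []; _∷_; universal)
open import Data.List.Relation.Unary.All.Properties using (map⁺; ++⁺; All¬⇒¬Any)
open import Data.List.Relation.Unary.AllPairs using ([]; _∷_)
open import Data.List.Relation.Unary.Any using (here; there)
open import Data.List.Relation.Unary.Unique.Propositional using (Unique)
open import Data.List.Relation.Unary.Unique.Propositional.Properties using (allFin⁺)
open import Data.Maybe using (Maybe; just; nothing)
open import Data.Nat using (ℕ; zero; suc; _+_; _*_; _∸_; _^_; _%_; _≤_; _<_; z≤n; s≤s; ⌊_/2⌋)
import Data.Nat as ℕ
open import Data.Nat.DivMod using ([m+n]%n≡m%n)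
open import Data.Nat.Induction using (<-rec)
open import Data.Nat.Properties
  using (+-suc; +-comm; +-identityʳ; *-suc; *-identityʳ; m+n∸n≡m; m≤n+m; m≤m*n; ≤-trans; ≤-refl; m≤m+n; n≤1+n;
         ⌊n/2⌋<n; n≡⌈n+n/2⌉; ^-distribˡ-+-*; m^n≢0; suc-injective; 1+n≢n; >⇒≢; <-irrefl; m<n⇒m<1+n; n<1+n)
open import Data.Nat.Solver using (module +-*-Solver)
open import Data.Product using (_×_; _,_; proj₁; proj₂)
open import Data.Vec using (Vec; []; _∷_; toList; lookup; tabulate)
open import Data.Vec.Properties using (lookup∘tabulate)
open import Function using (_∘_; id)
open import Relation.Binary.Definitions using (DecidableEquality)
open import Relation.Binary.PropositionalEquality hiding ([_])
open import Relation.Nullary using (¬_; does; yes; no; contradiction)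
open import Relation.Nullary.Decidable using (dec-true; dec-false)

open +-*-Solver using (solve; _:=_; _:+_; _:*_; con)

-- Sums over 𝔽₂

xor-interchange : ∀ a b c d → (a xor b) xor (c xor d) ≡ (a xor c) xor (b xor d)
xor-interchange = interchange (CommutativeRing.+-commutativeSemigroup xor-∧-commutativeRing)

∧-swap : ∀ a b c → a ∧ (b ∧ c) ≡ b ∧ (a ∧ c)
∧-swap = x∙yz≈y∙xz (CommutativeRing.*-commutativeSemigroup xor-∧-commutativeRing)

∧-cong-when : ∀ s {y y′} → (s ≡ true → y ≡ y′) → s ∧ y ≡ s ∧ y′
∧-cong-when true  h = h refl
∧-cong-when false h = refl

∧≡true : ∀ {a b} → a ∧ b ≡ true → a ≡ true × b ≡ true
∧≡true {true} {true} refl = refl , refl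

xorSum : {X : Set} → (X → Bool) → List X → Bool
xorSum f []       = false
xorSum f (x ∷ xs) = f x xor xorSum f xs

module _ {X : Set} where

  xorSum-false : (xs : List X) → xorSum (λ _ → false) xs ≡ false
  xorSum-false []       = refl
  xorSum-false (x ∷ xs) = xorSum-false xs

  xorSum-cong : {f g : X → Bool} → (∀ x → f x ≡ g x) → ∀ xs → xorSum f xs ≡ xorSum g xs
  xorSum-cong e []       = refl
  xorSum-cong e (x ∷ xs) = cong₂ _xor_ (e x) (xorSum-cong e xs)

  xorSum-cong-All : {f g : X → Bool} {P : X → Set} → (∀ x → P x → f x ≡ g x) →
                    ∀ {xs} → All P xs → xorSum f xs ≡ xorSum g xs
  xorSum-cong-All e []         = refl
  xorSum-cong-All e (px ∷ pxs) = cong₂ _xor_ (e _ px) (xorSum-cong-All e pxs)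

  xorSum-xor : (f g : X → Bool) → ∀ xs → xorSum (λ x → f x xor g x) xs ≡ xorSum f xs xor xorSum g xs
  xorSum-xor f g []       = refl
  xorSum-xor f g (x ∷ xs) =
    trans (cong ((f x xor g x) xor_) (xorSum-xor f g xs)) (xor-interchange (f x) (g x) _ _)

  ∧-distribˡ-xorSum : (b : Bool) (f : X → Bool) → ∀ xs → b ∧ xorSum f xs ≡ xorSum (λ x → b ∧ f x) xs
  ∧-distribˡ-xorSum b f []       = ∧-comm b false
  ∧-distribˡ-xorSum b f (x ∷ xs) =
    trans (∧-distribˡ-xor b (f x) _) (cong ((b ∧ f x) xor_) (∧-distribˡ-xorSum b f xs))

  ∧-distribʳ-xorSum : (b : Bool) (f : X → Bool) → ∀ xs → xorSum f xs ∧ b ≡ xorSum (λ x → f x ∧ b) xs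
  ∧-distribʳ-xorSum b f xs =
    trans (∧-comm (xorSum f xs) b)
      (trans (∧-distribˡ-xorSum b f xs) (xorSum-cong (λ x → ∧-comm b (f x)) xs))

  xorSum-++ : (f : X → Bool) → ∀ xs ys → xorSum f (xs ++ ys) ≡ xorSum f xs xor xorSum f ys
  xorSum-++ f []       ys = refl
  xorSum-++ f (x ∷ xs) ys = trans (cong (f x xor_) (xorSum-++ f xs ys)) (sym (xor-assoc (f x) _ _))

  xorSum-concat : (f : X → Bool) → ∀ xss → xorSum f (concat xss) ≡ xorSum (xorSum f) xss
  xorSum-concat f []         = refl
  xorSum-concat f (xs ∷ xss) = trans (xorSum-++ f xs (concat xss)) (cong (xorSum f xs xor_) (xorSum-concat f xss))

xorSum-map : {X Y : Set} (g : X → Y) (f : Y → Bool) → ∀ xs → xorSum f (map g xs) ≡ xorSum (λ x → f (g x)) xs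
xorSum-map g f []       = refl
xorSum-map g f (x ∷ xs) = cong (f (g x) xor_) (xorSum-map g f xs)

xorSum-concatMap : {X Y : Set} (f : Y → Bool) (g : X → List Y) → ∀ xs →
                   xorSum f (concatMap g xs) ≡ xorSum (λ x → xorSum f (g x)) xs
xorSum-concatMap f g xs = trans (xorSum-concat f (map g xs)) (xorSum-map g (xorSum f) xs)

xorSum-comm : {X Y : Set} (F : X → Y → Bool) → ∀ xs ys →
              xorSum (λ x → xorSum (F x) ys) xs ≡ xorSum (λ y → xorSum (λ x → F x y) xs) ys
xorSum-comm F []       ys = sym (xorSum-false ys)
xorSum-comm F (x ∷ xs) ys =
  trans (cong (xorSum (F x) ys xor_) (xorSum-comm F xs ys)) (sym (xorSum-xor (F x) _ ys))

-- Permanents modulo 2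

select : {B : Set} → List B → List (B × List B)
select []       = []
select (x ∷ xs) = (x , xs) ∷ map (λ (y , ys) → y , x ∷ ys) (select xs)

-- The permanent over 𝔽₂ of the R × C submatrix of M; it is false when R and C differ in length.
permanent : {A B : Set} → (A → B → Bool) → List A → List B → Bool
permanent M []      []      = true
permanent M []      (_ ∷ _) = false
permanent M (r ∷ R) C       = xorSum (λ (c , C′) → M r c ∧ permanent M R C′) (select C)

module _ {B : Set} where

  xorSum-select-∷ : (F : B × List B → Bool) (x : B) (xs : List B) →
    xorSum F (select (x ∷ xs)) ≡ F (x , xs) xor xorSum (λ (y , ys) → F (y , x ∷ ys)) (select xs)
  xorSum-select-∷ F x xs = cong (F (x , xs) xor_) (xorSum-map _ F (select xs))

  xorSum-select-++ : (F : B × List B → Bool) → ∀ xs ys →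
    xorSum F (select (xs ++ ys)) ≡
    xorSum (λ (z , zs) → F (z , zs ++ ys)) (select xs) xor xorSum (λ (z , zs) → F (z , xs ++ zs)) (select ys)
  xorSum-select-++ F []       ys = refl
  xorSum-select-++ F (x ∷ xs) ys =
    trans (xorSum-select-∷ F x (xs ++ ys))
      (trans (cong (F (x , xs ++ ys) xor_) (xorSum-select-++ (λ (z , zs) → F (z , x ∷ zs)) xs ys))
        (trans (sym (xor-assoc (F (x , xs ++ ys)) _ _))
          (cong (_xor xorSum (λ (z , zs) → F (z , x ∷ xs ++ zs)) (select ys))
            (sym (xorSum-select-∷ (λ (z , zs) → F (z , zs ++ ys)) x xs)))))

  select-All : (P : B → Set) → ∀ {xs} → All P xs → All (λ (y , ys) → P y × All P ys) (select xs)
  select-All P []         = []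
  select-All P (px ∷ pxs) = (px , pxs) ∷ push (select-All P pxs)
    where
    push : ∀ {L} → All (λ (y , ys) → P y × All P ys) L →
           All (λ (y , ys) → P y × All P ys) (map (λ (y , ys) → y , _ ∷ ys) L)
    push []                = []
    push ((py , pys) ∷ ps) = (py , px ∷ pys) ∷ push ps

  select-length : (xs : List B) → All (λ (_ , ys) → suc (length ys) ≡ length xs) (select xs)
  select-length []       = []
  select-length (x ∷ xs) = refl ∷ push (select-length xs)
    where
    push : ∀ {L} → All (λ (_ , ys) → suc (length ys) ≡ length xs) L →
           All (λ (_ , ys) → suc (length ys) ≡ suc (length xs)) (map (λ (y , ys) → y , x ∷ ys) L)
    push []       = []
    push (e ∷ es) = cong suc e ∷ push es

xorSum-select-map : {B B′ : Set} (g : B → B′) (F : B′ × List B′ → Bool) (C : List B) →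
  xorSum F (select (map g C)) ≡ xorSum (λ (c , C′) → F (g c , map g C′)) (select C)
xorSum-select-map g F []       = refl
xorSum-select-map g F (x ∷ xs) =
  trans (xorSum-select-∷ F (g x) (map g xs))
    (cong (F (g x , map g xs) xor_)
      (trans (xorSum-select-map g (λ (y , ys) → F (y , g x ∷ ys)) xs) (sym (xorSum-map _ _ (select xs)))))

module _ {A B : Set} where

  permanent-cong : {M M′ : A → B → Bool} → (∀ a b → M a b ≡ M′ a b) → ∀ R C → permanent M R C ≡ permanent M′ R C
  permanent-cong e []      []      = refl
  permanent-cong e []      (_ ∷ _) = refl
  permanent-cong e (r ∷ R) C       =
    xorSum-cong (λ (c , C′) → cong₂ _∧_ (e r c) (permanent-cong e R C′)) (select C)

  permanent-map-cols : {B′ : Set} (M : A → B′ → Bool) (g : B → B′) → ∀ R C →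
                       permanent M R (map g C) ≡ permanent (λ a b → M a (g b)) R C
  permanent-map-cols M g []      []      = refl
  permanent-map-cols M g []      (_ ∷ _) = refl
  permanent-map-cols M g (r ∷ R) C       =
    trans (xorSum-select-map g _ C)
      (xorSum-cong (λ (c , C′) → cong (M r (g c) ∧_) (permanent-map-cols M g R C′)) (select C))

permanent-map-rows : {A A′ B : Set} (M : A′ → B → Bool) (f : A → A′) → ∀ R C →
                     permanent M (map f R) C ≡ permanent (λ a → M (f a)) R C
permanent-map-rows M f []      []      = refl
permanent-map-rows M f []      (_ ∷ _) = refl
permanent-map-rows M f (r ∷ R) C       =
  xorSum-cong (λ (c , C′) → cong (M (f r) c ∧_) (permanent-map-rows M f R C′)) (select C)

module _ {A B : Set} (M : A → B → Bool) where

  permanent-column : ∀ R c C → permanent M R (c ∷ C) ≡ xorSum (λ (r , R′) → M r c ∧ permanent M R′ C) (select R)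
  permanent-column []      c C = refl
  permanent-column (x ∷ R) c C =
    trans (xorSum-select-∷ (λ (b , L) → M x b ∧ permanent M R L) c C)
      (cong (M x c ∧ permanent M R C xor_)
        (trans (xorSum-cong (λ (b , L) → trans (cong (M x b ∧_) (permanent-column R c L))
                                            (∧-distribˡ-xorSum (M x b) _ (select R))) (select C))
          (trans (xorSum-comm (λ (b , L) (r , R′) → M x b ∧ (M r c ∧ permanent M R′ L)) (select C) (select R))
            (trans (xorSum-cong (λ (r , R′) →
                      trans (xorSum-cong (λ (b , L) → ∧-swap (M x b) (M r c) (permanent M R′ L)) (select C))
                            (sym (∧-distribˡ-xorSum (M r c) _ (select C)))) (select R))
              (sym (xorSum-map _ _ (select R)))))))

  permanent-non-square : ∀ R C → ¬ length R ≡ length C → permanent M R C ≡ false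
  permanent-non-square []      []      ne = contradiction refl ne
  permanent-non-square []      (_ ∷ _) ne = refl
  permanent-non-square (r ∷ R) C       ne =
    trans (xorSum-cong-All (λ (c , C′) e → trans (cong (M r c ∧_)
                              (permanent-non-square R C′ (λ e′ → ne (trans (cong suc e′) e)))) (∧-zeroʳ (M r c)))
                           (select-length C))
      (xorSum-false (select C))

permanent-mismatch : {A B : Set} (M : A → B → Bool) → ∀ R C {r c} → length R ≡ r → length C ≡ c → ¬ r ≡ c →
                     permanent M R C ≡ false
permanent-mismatch M R C eR eC r≢c = permanent-non-square M R C (λ e → r≢c (trans (sym eR) (trans e eC)))

permanent-transpose : {A B : Set} (M : A → B → Bool) → ∀ R C → permanent M R C ≡ permanent (λ b a → M a b) C R
permanent-transpose M []      []      = refl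
permanent-transpose M []      (_ ∷ _) = refl
permanent-transpose M (r ∷ R) C       =
  trans (xorSum-cong (λ (c , C′) → cong (M r c ∧_) (permanent-transpose M R C′)) (select C))
    (sym (permanent-column (λ b a → M a b) C r R))

-- Row operations

pairSum : {B : Set} → (B → B → List B → Bool) → List B → Bool
pairSum F C = xorSum (λ (a , C′) → xorSum (λ (b , C″) → F a b C″) (select C′)) (select C)

module _ {B : Set} where

  pairSum-∷ : (F : B → B → List B → Bool) (x : B) (xs : List B) →
    pairSum F (x ∷ xs) ≡
    (xorSum (λ (b , L) → F x b L) (select xs) xor xorSum (λ (a , L) → F a x L) (select xs))
      xor pairSum (λ a b L → F a b (x ∷ L)) xs
  pairSum-∷ F x xs =
    trans (cong (xorSum (λ (b , L) → F x b L) (select xs) xor_)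
      (trans (xorSum-map _ _ (select xs))
        (trans (xorSum-cong (λ (a , L) → xorSum-select-∷ (λ (b , L′) → F a b L′) x L) (select xs))
          (xorSum-xor (λ (a , L) → F a x L) _ (select xs)))))
      (sym (xor-assoc (xorSum (λ (b , L) → F x b L) (select xs)) _ _))

  pairSum-flip : (F : B → B → List B → Bool) (C : List B) → pairSum F C ≡ pairSum (λ a b → F b a) C
  pairSum-flip F []       = refl
  pairSum-flip F (x ∷ xs) =
    trans (pairSum-∷ F x xs)
      (trans (cong₂ _xor_ (xor-comm (xorSum (λ (b , L) → F x b L) (select xs)) _)
                          (pairSum-flip (λ a b L → F a b (x ∷ L)) xs))
        (sym (pairSum-∷ (λ a b → F b a) x xs)))

  pairSum-symmetric : (F : B → B → List B → Bool) → (∀ a b L → F a b L ≡ F b a L) → (C : List B) → pairSum F C ≡ false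
  pairSum-symmetric F s []       = refl
  pairSum-symmetric F s (x ∷ xs) =
    trans (pairSum-∷ F x xs)
      (trans (cong₂ _xor_
                (trans (cong (xorSum (λ (b , L) → F x b L) (select xs) xor_) (xorSum-cong (λ (a , L) → s a x L) (select xs)))
                       (xor-same (xorSum (λ (b , L) → F x b L) (select xs))))
                (pairSum-symmetric (λ a b L → F a b (x ∷ L)) (λ a b L → s a b (x ∷ L)) xs))
        refl)

module _ {A B : Set} (M : A → B → Bool) where

  private
    permanent-∷∷ : ∀ x y R C → permanent M (x ∷ y ∷ R) C ≡ pairSum (λ a b L → M x a ∧ (M y b ∧ permanent M R L)) C
    permanent-∷∷ x y R C = xorSum-cong (λ (a , L) → ∧-distribˡ-xorSum (M x a) _ (select L)) (select C)

  permanent-swap : ∀ x y R C → permanent M (x ∷ y ∷ R) C ≡ permanent M (y ∷ x ∷ R) C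
  permanent-swap x y R C =
    trans (permanent-∷∷ x y R C)
      (trans (pairSum-flip _ C)
        (trans (xorSum-cong (λ (a , L) → xorSum-cong (λ (b , L′) → ∧-swap (M x b) (M y a) (permanent M R L′)) (select L))
                            (select C))
          (sym (permanent-∷∷ y x R C))))

  permanent-↭ : ∀ {R R′} → R ↭ R′ → ∀ C → permanent M R C ≡ permanent M R′ C
  permanent-↭ ↭.refl           C = refl
  permanent-↭ (↭.prep x p)     C = xorSum-cong (λ (c , L) → cong (M x c ∧_) (permanent-↭ p L)) (select C)
  permanent-↭ (↭.swap {xs = R} x y p) C =
    trans (permanent-swap x y R C)
      (xorSum-cong (λ (c , L) → cong (M y c ∧_)
        (xorSum-cong (λ (c′ , L′) → cong (M x c′ ∧_) (permanent-↭ p L′)) (select L))) (select C))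
  permanent-↭ (↭.trans p q)    C = trans (permanent-↭ p C) (permanent-↭ q C)

  permanent-∷ʳ : ∀ v xs C → permanent M (xs ++ [ v ]) C ≡ permanent M (v ∷ xs) C
  permanent-∷ʳ v xs C = trans (permanent-↭ (shift v xs []) C) (cong (λ L → permanent M (v ∷ L) C) (++-identityʳ xs))

  permanent-prefix-xor : ∀ {L L₁ L₂} → (∀ C → permanent M L C ≡ permanent M L₁ C xor permanent M L₂ C) →
    ∀ P C → permanent M (P ++ L) C ≡ permanent M (P ++ L₁) C xor permanent M (P ++ L₂) C
  permanent-prefix-xor h []      C = h C
  permanent-prefix-xor h (p ∷ P) C =
    trans (xorSum-cong (λ (c , L) → trans (cong (M p c ∧_) (permanent-prefix-xor h P L)) (∧-distribˡ-xor (M p c) _ _)) (select C))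
      (xorSum-xor _ _ (select C))

  permanent-prefix-false : ∀ {L} → (∀ C → permanent M L C ≡ false) → ∀ P C → permanent M (P ++ L) C ≡ false
  permanent-prefix-false h []      C = h C
  permanent-prefix-false h (p ∷ P) C =
    trans (xorSum-cong (λ (c , L) → trans (cong (M p c ∧_) (permanent-prefix-false h P L)) (∧-zeroʳ (M p c))) (select C))
      (xorSum-false (select C))

  permanent-linear-head : ∀ x y z → (∀ c → M x c ≡ M y c xor M z c) →
    ∀ L C → permanent M (x ∷ L) C ≡ permanent M (y ∷ L) C xor permanent M (z ∷ L) C
  permanent-linear-head x y z e L C =
    trans (xorSum-cong (λ (c , L′) → trans (cong (_∧ permanent M L L′) (e c)) (∧-distribʳ-xor _ (M y c) (M z c))) (select C))
      (xorSum-xor _ _ (select C))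

  permanent-linear : ∀ x y z → (∀ c → M x c ≡ M y c xor M z c) →
    ∀ P L C → permanent M (P ++ x ∷ L) C ≡ permanent M (P ++ y ∷ L) C xor permanent M (P ++ z ∷ L) C
  permanent-linear x y z e P L = permanent-prefix-xor (permanent-linear-head x y z e L) P

  permanent-equal-rows : ∀ x y → (∀ c → M x c ≡ M y c) → ∀ P Q R C → permanent M (P ++ x ∷ Q ++ y ∷ R) C ≡ false
  permanent-equal-rows x y e P Q R = permanent-prefix-false adjacent P
    where
    adjacent : ∀ C → permanent M (x ∷ Q ++ y ∷ R) C ≡ false
    adjacent C =
      trans (permanent-↭ (↭.prep x (shift y Q R)) C)
        (trans (permanent-∷∷ x y (Q ++ R) C)
          (pairSum-symmetric _ (λ a b L → trans (cong (_∧ (M y b ∧ permanent M (Q ++ R) L)) (e a))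
             (trans (∧-swap (M y a) (M y b) _) (cong (_∧ (M y a ∧ permanent M (Q ++ R) L)) (sym (e b))))) C))

replaceOne : {A : Set} → A → List A → List (List A)
replaceOne o []       = []
replaceOne o (y ∷ ys) = (o ∷ ys) ∷ map (y ∷_) (replaceOne o ys)

module _ {A : Set} where

  xorSum-replaceOne-∷ : (F : List A → Bool) (o y : A) (ys : List A) →
    xorSum F (replaceOne o (y ∷ ys)) ≡ F (o ∷ ys) xor xorSum (λ L → F (y ∷ L)) (replaceOne o ys)
  xorSum-replaceOne-∷ F o y ys = cong (F (o ∷ ys) xor_) (xorSum-map _ F (replaceOne o ys))

  xorSum-replaceOne-++ : (F : List A → Bool) (o : A) → ∀ xs ys →
    xorSum F (replaceOne o (xs ++ ys)) ≡
    xorSum (λ L → F (L ++ ys)) (replaceOne o xs) xor xorSum (λ L → F (xs ++ L)) (replaceOne o ys)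
  xorSum-replaceOne-++ F o []       ys = refl
  xorSum-replaceOne-++ F o (x ∷ xs) ys =
    trans (xorSum-replaceOne-∷ F o x (xs ++ ys))
      (trans (cong (F (o ∷ xs ++ ys) xor_) (xorSum-replaceOne-++ (λ L → F (x ∷ L)) o xs ys))
        (trans (sym (xor-assoc (F (o ∷ xs ++ ys)) _ _))
          (cong (_xor xorSum (λ L → F (x ∷ xs ++ L)) (replaceOne o ys))
            (sym (xorSum-replaceOne-∷ (λ L → F (L ++ ys)) o x xs)))))

  replaceOne-All : (P : A → Set) {o : A} → P o → ∀ {xs} → All P xs → All (All P) (replaceOne o xs)
  replaceOne-All P po []         = []
  replaceOne-All P po (px ∷ pxs) = (po ∷ pxs) ∷ push (replaceOne-All P po pxs)
    where
    push : ∀ {Ls} → All (All P) Ls → All (All P) (map (_ ∷_) Ls)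
    push []       = []
    push (l ∷ ls) = (px ∷ l) ∷ push ls

  replaceOne-length : (o : A) → ∀ xs → All (λ L → length L ≡ length xs) (replaceOne o xs)
  replaceOne-length o []       = []
  replaceOne-length o (x ∷ xs) = refl ∷ push (replaceOne-length o xs)
    where
    push : ∀ {Ls} → All (λ L → length L ≡ length xs) Ls → All (λ L → length L ≡ suc (length xs)) (map (x ∷_) Ls)
    push []       = []
    push (e ∷ es) = cong suc e ∷ push es

  xorSum-replaceOne-linear : (F : List A → Bool) {o o₁ o₂ : A} →
    (∀ P S → F (P ++ o ∷ S) ≡ F (P ++ o₁ ∷ S) xor F (P ++ o₂ ∷ S)) →
    ∀ xs → xorSum F (replaceOne o xs) ≡ xorSum F (replaceOne o₁ xs) xor xorSum F (replaceOne o₂ xs)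
  xorSum-replaceOne-linear F h []       = refl
  xorSum-replaceOne-linear F {o} {o₁} {o₂} h (x ∷ xs) =
    trans (xorSum-replaceOne-∷ F o x xs)
      (trans (cong₂ _xor_ (h [] xs) (xorSum-replaceOne-linear (λ L → F (x ∷ L)) (λ P → h (x ∷ P)) xs))
        (trans (xor-interchange (F (o₁ ∷ xs)) (F (o₂ ∷ xs)) _ _)
          (sym (cong₂ _xor_ (xorSum-replaceOne-∷ F o₁ x xs) (xorSum-replaceOne-∷ F o₂ x xs)))))

xorSum-replaceOne-map : {A A′ : Set} (f : A → A′) (F : List A′ → Bool) (o : A) → ∀ ys →
  xorSum F (replaceOne (f o) (map f ys)) ≡ xorSum (λ L → F (map f L)) (replaceOne o ys)
xorSum-replaceOne-map f F o []       = refl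
xorSum-replaceOne-map f F o (y ∷ ys) =
  trans (xorSum-replaceOne-∷ F (f o) (f y) (map f ys))
    (trans (cong (F (f o ∷ map f ys) xor_) (xorSum-replaceOne-map f (λ L → F (f y ∷ L)) o ys))
      (sym (xorSum-replaceOne-∷ (λ L → F (map f L)) o y ys)))

module _ {A B : Set} (M : A → B → Bool) where

  data Offset (o : A) : List A → List A → Set where
    []  : Offset o [] []
    _∷_ : ∀ {x y xs ys} → (∀ c → M x c ≡ M o c xor M y c) → Offset o xs ys → Offset o (x ∷ xs) (y ∷ ys)

  permanent-offset-absorbed : ∀ {o xs ys} → Offset o xs ys →
    ∀ P Q C → permanent M (P ++ o ∷ Q ++ xs) C ≡ permanent M (P ++ o ∷ Q ++ ys) C
  permanent-offset-absorbed []                                     P Q C = refl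
  permanent-offset-absorbed {o} (_∷_ {x} {y} {xs} {ys} e offset) P Q C =
    begin
      permanent M (P ++ o ∷ Q ++ x ∷ xs) C
    ≡⟨ cong (λ L → permanent M L C) (sym (++-assoc P (o ∷ Q) (x ∷ xs))) ⟩
      permanent M ((P ++ o ∷ Q) ++ x ∷ xs) C
    ≡⟨ permanent-linear M x o y e (P ++ o ∷ Q) xs C ⟩
      permanent M ((P ++ o ∷ Q) ++ o ∷ xs) C xor permanent M ((P ++ o ∷ Q) ++ y ∷ xs) C
    ≡⟨ cong₂ _xor_ (trans (cong (λ L → permanent M L C) (++-assoc P (o ∷ Q) (o ∷ xs)))
                          (permanent-equal-rows M o o (λ _ → refl) P Q xs C))
                   (cong (λ L → permanent M L C)
                     (trans (++-assoc P (o ∷ Q) (y ∷ xs)) (cong (λ L → P ++ o ∷ L) (sym (++-assoc Q [ y ] xs))))) ⟩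
      permanent M (P ++ o ∷ (Q ++ [ y ]) ++ xs) C
    ≡⟨ permanent-offset-absorbed offset P (Q ++ [ y ]) C ⟩
      permanent M (P ++ o ∷ (Q ++ [ y ]) ++ ys) C
    ≡⟨ cong (λ L → permanent M (P ++ o ∷ L) C) (++-assoc Q [ y ] ys) ⟩
      permanent M (P ++ o ∷ Q ++ y ∷ ys) C
    ∎
    where open ≡-Reasoning

  -- Expanding each row of xs as o ⊕ y, every term with o in two rows vanishes.
  permanent-offset : ∀ {o xs ys} → Offset o xs ys → ∀ P C →
    permanent M (P ++ xs) C ≡ permanent M (P ++ ys) C xor xorSum (λ L → permanent M (P ++ L) C) (replaceOne o ys)
  permanent-offset []                                     P C = sym (xor-identityʳ _)
  permanent-offset {o} (_∷_ {x} {y} {xs} {ys} e offset) P C =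
    begin
      per (P ++ x ∷ xs)
    ≡⟨ permanent-linear M x y o (λ c → trans (e c) (xor-comm (M o c) (M y c))) P xs C ⟩
      per (P ++ y ∷ xs) xor per (P ++ o ∷ xs)
    ≡⟨ cong₂ _xor_ (trans (cong per (sym (++-assoc P [ y ] xs))) (permanent-offset offset (P ++ [ y ]) C))
                   (permanent-offset-absorbed offset P [] C) ⟩
      (per ((P ++ [ y ]) ++ ys) xor xorSum (λ L → per ((P ++ [ y ]) ++ L)) (replaceOne o ys)) xor per (P ++ o ∷ ys)
    ≡⟨ cong (λ t → (t xor xorSum (λ L → per ((P ++ [ y ]) ++ L)) (replaceOne o ys)) xor per (P ++ o ∷ ys))
            (cong per (++-assoc P [ y ] ys)) ⟩
      (per (P ++ y ∷ ys) xor xorSum (λ L → per ((P ++ [ y ]) ++ L)) (replaceOne o ys)) xor per (P ++ o ∷ ys)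
    ≡⟨ cong (λ t → (per (P ++ y ∷ ys) xor t) xor per (P ++ o ∷ ys))
            (xorSum-cong (λ L → cong per (++-assoc P [ y ] L)) (replaceOne o ys)) ⟩
      (per (P ++ y ∷ ys) xor xorSum (λ L → per (P ++ y ∷ L)) (replaceOne o ys)) xor per (P ++ o ∷ ys)
    ≡⟨ xor-assoc (per (P ++ y ∷ ys)) _ _ ⟩
      per (P ++ y ∷ ys) xor (xorSum (λ L → per (P ++ y ∷ L)) (replaceOne o ys) xor per (P ++ o ∷ ys))
    ≡⟨ cong (per (P ++ y ∷ ys) xor_) (trans (xor-comm _ (per (P ++ o ∷ ys)))
                                              (sym (xorSum-replaceOne-∷ (λ L → per (P ++ L)) o y ys))) ⟩
      per (P ++ y ∷ ys) xor xorSum (λ L → per (P ++ L)) (replaceOne o (y ∷ ys))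
    ∎
    where
    open ≡-Reasoning
    per : List A → Bool
    per L = permanent M L C

-- Block-diagonal permanents

module _ {X : Set} (q : X → Bool) where

  filterᵇ-accept : ∀ {x L} → q x ≡ true → filterᵇ q (x ∷ L) ≡ x ∷ filterᵇ q L
  filterᵇ-accept e rewrite e = refl

  filterᵇ-reject : ∀ {x L} → q x ≡ false → filterᵇ q (x ∷ L) ≡ filterᵇ q L
  filterᵇ-reject e rewrite e = refl

  filterᵇ-all : ∀ {xs} → All (λ x → q x ≡ true) xs → filterᵇ q xs ≡ xs
  filterᵇ-all []       = refl
  filterᵇ-all (e ∷ es) = trans (filterᵇ-accept e) (cong (_ ∷_) (filterᵇ-all es))

  filterᵇ-none : ∀ {xs} → All (λ x → q x ≡ false) xs → filterᵇ q xs ≡ []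
  filterᵇ-none []       = refl
  filterᵇ-none (e ∷ es) = trans (filterᵇ-reject e) (filterᵇ-none es)

filterᵇ-map : {X Y : Set} (q : Y → Bool) (f : X → Y) → ∀ xs → filterᵇ q (map f xs) ≡ map f (filterᵇ (q ∘ f) xs)
filterᵇ-map q f []       = refl
filterᵇ-map q f (x ∷ xs) with q (f x)
... | true  = cong (f x ∷_) (filterᵇ-map q f xs)
... | false = filterᵇ-map q f xs

filterᵇ-cong : {X : Set} {q q′ : X → Bool} → (∀ x → q x ≡ q′ x) → ∀ xs → filterᵇ q xs ≡ filterᵇ q′ xs
filterᵇ-cong {q = q} {q′} e []       = refl
filterᵇ-cong {q = q} {q′} e (x ∷ xs) rewrite e x with q′ x
... | true  = cong (x ∷_) (filterᵇ-cong e xs)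
... | false = filterᵇ-cong e xs

module _ {A : Set} (τ : A → Bool) where

  private
    notAll : ∀ {b xs} → All (λ x → τ x ≡ b) xs → All (λ x → not (τ x) ≡ not b) xs
    notAll = All.map (cong not)

  xorSum-replaceOne-partition-newʳ : (H : List A → List A → Bool) → ∀ {y xs} → All (λ x → τ x ≡ true) xs → τ y ≡ false →
    xorSum (λ L → H (filterᵇ τ L) (filterᵇ (not ∘ τ) L)) (replaceOne y xs) ≡ xorSum (λ (_ , R) → H R [ y ]) (select xs)
  xorSum-replaceOne-partition-newʳ H {y} {[]}     []         τy = refl
  xorSum-replaceOne-partition-newʳ H {y} {x ∷ xs} (τx ∷ τxs) τy =
    trans (xorSum-replaceOne-∷ (λ L → H (filterᵇ τ L) (filterᵇ (not ∘ τ) L)) y x xs)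
      (trans (cong₂ _xor_
                (cong₂ H (trans (filterᵇ-reject τ {L = xs} τy) (filterᵇ-all τ τxs))
                         (trans (filterᵇ-accept (not ∘ τ) {L = xs} (cong not τy))
                                (cong (y ∷_) (filterᵇ-none (not ∘ τ) (notAll τxs)))))
                (trans (xorSum-cong (λ L → cong₂ H (filterᵇ-accept τ {L = L} τx) (filterᵇ-reject (not ∘ τ) {L = L} (cong not τx)))
                                    (replaceOne y xs))
                       (xorSum-replaceOne-partition-newʳ (λ U V → H (x ∷ U) V) τxs τy)))
        (sym (xorSum-select-∷ (λ (_ , R) → H R [ y ]) x xs)))

  xorSum-replaceOne-partition-newˡ : (H : List A → List A → Bool) → ∀ {y xs} → All (λ x → τ x ≡ false) xs → τ y ≡ true →
    xorSum (λ L → H (filterᵇ τ L) (filterᵇ (not ∘ τ) L)) (replaceOne y xs) ≡ xorSum (λ (_ , R) → H [ y ] R) (select xs)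
  xorSum-replaceOne-partition-newˡ H {y} {[]}     []         τy = refl
  xorSum-replaceOne-partition-newˡ H {y} {x ∷ xs} (τx ∷ τxs) τy =
    trans (xorSum-replaceOne-∷ (λ L → H (filterᵇ τ L) (filterᵇ (not ∘ τ) L)) y x xs)
      (trans (cong₂ _xor_
                (cong₂ H (trans (filterᵇ-accept τ {L = xs} τy) (cong (y ∷_) (filterᵇ-none τ τxs)))
                         (trans (filterᵇ-reject (not ∘ τ) {L = xs} (cong not τy)) (filterᵇ-all (not ∘ τ) (notAll τxs))))
                (trans (xorSum-cong (λ L → cong₂ H (filterᵇ-reject τ {L = L} τx) (filterᵇ-accept (not ∘ τ) {L = L} (cong not τx)))
                                    (replaceOne y xs))
                       (xorSum-replaceOne-partition-newˡ (λ U V → H U (x ∷ V)) τxs τy)))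
        (sym (xorSum-select-∷ (λ (_ , R) → H [ y ] R) x xs)))

  xorSum-replaceOne-partition-allˡ : (H : List A → List A → Bool) → ∀ {y xs} → All (λ x → τ x ≡ true) xs → τ y ≡ true →
    xorSum (λ L → H (filterᵇ τ L) (filterᵇ (not ∘ τ) L)) (replaceOne y xs) ≡ xorSum (λ L → H L []) (replaceOne y xs)
  xorSum-replaceOne-partition-allˡ H τxs τy =
    xorSum-cong-All (λ L τL → cong₂ H (filterᵇ-all τ τL) (filterᵇ-none (not ∘ τ) (notAll τL)))
                    (replaceOne-All _ τy τxs)

  xorSum-replaceOne-partition-allʳ : (H : List A → List A → Bool) → ∀ {y xs} → All (λ x → τ x ≡ false) xs → τ y ≡ false →
    xorSum (λ L → H (filterᵇ τ L) (filterᵇ (not ∘ τ) L)) (replaceOne y xs) ≡ xorSum (λ L → H [] L) (replaceOne y xs)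
  xorSum-replaceOne-partition-allʳ H τxs τy =
    xorSum-cong-All (λ L τL → cong₂ H (filterᵇ-none τ τL) (filterᵇ-all (not ∘ τ) (notAll τL)))
                    (replaceOne-All _ τy τxs)

module _ {B : Set} (q q̄ : B → Bool) (complement : ∀ c → q̄ c ≡ not (q c)) where

  xorSum-select-filterᵇ : (G : B → List B → List B → Bool) → ∀ C →
    xorSum (λ (c , C′) → q c ∧ G c (filterᵇ q C′) (filterᵇ q̄ C′)) (select C) ≡
    xorSum (λ (c , C′) → G c C′ (filterᵇ q̄ C)) (select (filterᵇ q C))
  xorSum-select-filterᵇ G []       = refl
  xorSum-select-filterᵇ G (x ∷ xs) with q x in eq | q̄ x in eq̄
  ... | true  | false =
    cong (G x (filterᵇ q xs) (filterᵇ q̄ xs) xor_)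
      (trans (xorSum-map _ _ (select xs))
        (trans (xorSum-cong (λ (c , L) → cong₂ (λ U V → q c ∧ G c U V) (filterᵇ-accept q eq) (filterᵇ-reject q̄ eq̄))
                            (select xs))
          (trans (xorSum-select-filterᵇ (λ c U V → G c (x ∷ U) V) xs) (sym (xorSum-map _ _ (select (filterᵇ q xs)))))))
  ... | false | true  =
    trans (xorSum-map _ _ (select xs))
      (trans (xorSum-cong (λ (c , L) → cong₂ (λ U V → q c ∧ G c U V) (filterᵇ-reject q eq) (filterᵇ-accept q̄ eq̄))
                          (select xs))
        (xorSum-select-filterᵇ (λ c U V → G c U (x ∷ V)) xs))
  ... | true  | true  = contradiction (trans (sym eq̄) (trans (complement x) (cong not eq))) λ ()
  ... | false | false = contradiction (trans (sym eq̄) (trans (complement x) (cong not eq))) λ ()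

module _ {A B : Set} (M : A → B → Bool) (p : B → Bool) (τ : A → Bool) where

  SupportedIn : A → Set
  SupportedIn r = ∀ c → M r c ≡ true → p c ≡ τ r

  permanent-blockDiagonal : ∀ {R} → All SupportedIn R → ∀ C →
    permanent M R C ≡ permanent M (filterᵇ τ R) (filterᵇ p C) ∧ permanent M (filterᵇ (not ∘ τ) R) (filterᵇ (not ∘ p) C)
  permanent-blockDiagonal [] [] = refl
  permanent-blockDiagonal [] (c ∷ C) with p c
  ... | true  = refl
  ... | false = sym (∧-zeroʳ _)
  permanent-blockDiagonal {r ∷ R} (s ∷ ss) C with τ r in eq
  ... | true =
    trans (xorSum-cong step (select C))
      (trans (xorSum-select-filterᵇ p (not ∘ p) (λ _ → refl) G C)
        (trans (xorSum-cong (λ (c , C′) → sym (∧-assoc (M r c) _ _)) (select (filterᵇ p C)))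
          (sym (∧-distribʳ-xorSum (lower (filterᵇ (not ∘ p) C)) _ (select (filterᵇ p C))))))
    where
    upper lower : List B → Bool
    upper = permanent M (filterᵇ τ R)
    lower = permanent M (filterᵇ (not ∘ τ) R)
    G : B → List B → List B → Bool
    G c U V = M r c ∧ upper U ∧ lower V
    mask : ∀ c → M r c ≡ p c ∧ M r c
    mask c with M r c in e
    ... | false = sym (∧-zeroʳ (p c))
    ... | true  rewrite s c e = refl
    step : ∀ ((c , C′) : B × List B) → M r c ∧ permanent M R C′ ≡ p c ∧ G c (filterᵇ p C′) (filterᵇ (not ∘ p) C′)
    step (c , C′) =
      trans (cong (M r c ∧_) (permanent-blockDiagonal ss C′))
        (trans (cong (_∧ (upper (filterᵇ p C′) ∧ lower (filterᵇ (not ∘ p) C′))) (mask c))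
          (∧-assoc (p c) (M r c) _))
  ... | false =
    trans (xorSum-cong step (select C))
      (trans (xorSum-select-filterᵇ (not ∘ p) p (λ c → sym (not-involutive (p c))) G C)
        (sym (∧-distribˡ-xorSum (upper (filterᵇ p C)) _ (select (filterᵇ (not ∘ p) C)))))
    where
    upper lower : List B → Bool
    upper = permanent M (filterᵇ τ R)
    lower = permanent M (filterᵇ (not ∘ τ) R)
    G : B → List B → List B → Bool
    G c U V = upper V ∧ (M r c ∧ lower U)
    mask : ∀ c → M r c ≡ not (p c) ∧ M r c
    mask c with M r c in e
    ... | false = sym (∧-zeroʳ (not (p c)))
    ... | true  rewrite s c e = refl
    step : ∀ ((c , C′) : B × List B) → M r c ∧ permanent M R C′ ≡ not (p c) ∧ G c (filterᵇ (not ∘ p) C′) (filterᵇ p C′)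
    step (c , C′) =
      trans (cong (M r c ∧_) (permanent-blockDiagonal ss C′))
        (trans (cong (_∧ (upper (filterᵇ p C′) ∧ lower (filterᵇ (not ∘ p) C′))) (mask c))
          (trans (∧-assoc (not (p c)) (M r c) _)
            (cong (not (p c) ∧_) (∧-swap (M r c) (upper (filterᵇ p C′)) (lower (filterᵇ (not ∘ p) C′))))))

-- The sets J and K

isEven : ℕ → Bool
isEven zero    = true
isEven (suc n) = not (isEven n)

isEven-double : ∀ a → isEven (a + a) ≡ true
isEven-double zero    = refl
isEven-double (suc a) rewrite +-suc a a = trans (not-involutive _) (isEven-double a)

isEven-+ : ∀ i c → isEven (i + c) ≡ not (isEven i xor isEven c)
isEven-+ zero    c with isEven c
... | true  = refl
... | false = refl
isEven-+ (suc i) c rewrite isEven-+ i c with isEven i | isEven c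
... | true  | true  = refl
... | true  | false = refl
... | false | true  = refl
... | false | false = refl

data ParityView : ℕ → Set where
  even : ∀ p → ParityView (p + p)
  odd  : ∀ p → ParityView (suc (p + p))

parityView : ∀ n → ParityView n
parityView zero    = even 0
parityView (suc n) with parityView n
... | even p = odd p
... | odd p  = subst ParityView (+-suc (suc p) p) (even (suc p))

-- x ∈ J iff x is even, or x = 2a + 1 with a ∉ J; fuel x + 1 suffices because the argument halves.
isJ-fuel : ℕ → ℕ → Bool
isJ-fuel zero    x = true
isJ-fuel (suc f) x = if isEven x then true else not (isJ-fuel f ⌊ x /2⌋)

isJ : ℕ → Bool
isJ x = isJ-fuel (suc x) x

isK : ℕ → Bool
isK x = not (isJ x)

isJ-fuel-irrelevant : ∀ f f′ x → x < f → x < f′ → isJ-fuel f x ≡ isJ-fuel f′ x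
isJ-fuel-irrelevant (suc f) (suc f′) x (s≤s x≤f) (s≤s x≤f′) with isEven x in e
... | true = refl
isJ-fuel-irrelevant (suc f) (suc f′) zero    _         _          | false = contradiction e λ ()
isJ-fuel-irrelevant (suc f) (suc f′) (suc y) (s≤s y<f) (s≤s y<f′) | false =
  cong not (isJ-fuel-irrelevant f f′ ⌊ suc y /2⌋ (≤-trans (⌊n/2⌋<n y) y<f) (≤-trans (⌊n/2⌋<n y) y<f′))

isJ-double : ∀ a → isJ (a + a) ≡ true
isJ-double a rewrite isEven-double a = refl

isJ-odd : ∀ a → isJ (suc (a + a)) ≡ not (isJ a)
isJ-odd a rewrite isEven-double a | sym (n≡⌈n+n/2⌉ a) =
  cong not (isJ-fuel-irrelevant (suc (a + a)) (suc a) a (s≤s (m≤m+n a a)) ≤-refl)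

isK-double : ∀ n → isK (n + n) ≡ false
isK-double n = cong not (isJ-double n)

isK⇒odd : ∀ x → isK x ≡ true → isEven x ≡ false
isK⇒odd x h with parityView x
... | even p = contradiction (trans (sym h) (cong not (isJ-double p))) λ ()
... | odd p  = cong not (isEven-double p)

isK-support : ∀ i c → isK (i + c) ≡ true → not (isEven c) ≡ isEven i
isK-support i c h with isEven i | isEven c | trans (sym (isEven-+ i c)) (isK⇒odd (i + c) h)
... | true  | false | _ = refl
... | false | true  | _ = refl
... | true  | true  | ()
... | false | false | ()

isK-even+odd : ∀ a b → isK ((a + a) + suc (b + b)) ≡ isJ (a + b)
isK-even+odd a b = trans (cong isK reorder) (trans (cong not (isJ-odd (a + b))) (not-involutive _))
  where
  reorder : (a + a) + suc (b + b) ≡ suc ((a + b) + (a + b))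
  reorder = solve 2 (λ a b → (a :+ a) :+ (con 1 :+ (b :+ b)) := con 1 :+ ((a :+ b) :+ (a :+ b))) refl a b

isK-odd+even : ∀ b a → isK (suc (b + b) + (a + a)) ≡ isJ (b + a)
isK-odd+even b a = trans (cong isK reorder) (trans (cong not (isJ-odd (b + a))) (not-involutive _))
  where
  reorder : suc (b + b) + (a + a) ≡ suc ((b + a) + (b + a))
  reorder = solve 2 (λ b a → (con 1 :+ (b :+ b)) :+ (a :+ a) := con 1 :+ ((b :+ a) :+ (b :+ a))) refl b a

4x+3 : ℕ → ℕ
4x+3 w = suc (suc (w + w) + suc (w + w))

isJ-4x+3 : ∀ w → isJ (4x+3 w) ≡ isJ w
isJ-4x+3 w = trans (isJ-odd (suc (w + w))) (trans (cong not (isJ-odd w)) (not-involutive _))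

jElement : ℕ → ℕ → ℕ
jElement n k = (2 * n + 1) * 2 ^ (2 * k) ∸ 1

jElement-zero : ∀ n → jElement n 0 ≡ n + n
jElement-zero n rewrite *-identityʳ (2 * n + 1) | m+n∸n≡m (2 * n) 1 = cong (n +_) (+-identityʳ n)

jElement-suc : ∀ n k → jElement n (suc k) ≡ 4x+3 (jElement n k)
jElement-suc n k = trans (cong (_∸ 1) quadruple) (pred-quadruple u positive)
  where
  u : ℕ
  u = (2 * n + 1) * 2 ^ (2 * k)
  positive : 0 < u
  positive = ≤-trans (m≤n+m 1 (2 * n)) (m≤m*n (2 * n + 1) (2 ^ (2 * k)) {{m^n≢0 2 (2 * k)}})
  quadruple : (2 * n + 1) * 2 ^ (2 * suc k) ≡ 4 * u
  quadruple = trans (cong (λ e → (2 * n + 1) * 2 ^ e) (*-suc 2 k))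
    (trans (cong ((2 * n + 1) *_) (^-distribˡ-+-* 2 2 (2 * k)))
      (solve 2 (λ a p → a :* (con 4 :* p) := con 4 :* (a :* p)) refl (2 * n + 1) (2 ^ (2 * k))))
  pred-quadruple : ∀ u → 0 < u → 4 * u ∸ 1 ≡ 4x+3 (u ∸ 1)
  pred-quadruple (suc v) _ =
    solve 1 (λ v → v :+ (con 1 :+ (v :+ (con 1 :+ (v :+ (con 1 :+ (v :+ con 0))))))
                := con 1 :+ ((con 1 :+ (v :+ v)) :+ (con 1 :+ (v :+ v)))) refl v

Jset⇒isJ : ∀ x → Jset x → isJ x ≡ true
Jset⇒isJ x (n , k , refl) = go k
  where
  go : ∀ k → isJ (jElement n k) ≡ true
  go zero    = trans (cong isJ (jElement-zero n)) (isJ-double n)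
  go (suc k) = trans (cong isJ (jElement-suc n k)) (trans (isJ-4x+3 (jElement n k)) (go k))

isJ⇒Jset : ∀ x → isJ x ≡ true → Jset x
isJ⇒Jset = <-rec _ λ x rec → go x (parityView x) rec
  where
  r<4r+3 : ∀ r → r < 4x+3 r
  r<4r+3 r = s≤s (≤-trans (m≤m+n r r) (≤-trans (n≤1+n (r + r)) (m≤m+n (suc (r + r)) (suc (r + r)))))
  go : ∀ x → ParityView x → (∀ {y} → y < x → isJ y ≡ true → Jset y) → isJ x ≡ true → Jset x
  go _ (even p) rec h = p , 0 , sym (jElement-zero p)
  go _ (odd p)  rec h with parityView p
  ... | even r = contradiction (trans (sym h) (trans (isJ-odd (r + r)) (cong not (isJ-double r)))) λ ()
  ... | odd r with rec (r<4r+3 r) (trans (sym (isJ-4x+3 r)) h)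
  ...   | n , k , e = n , suc k , trans (cong 4x+3 e) (sym (jElement-suc n k))

Kset⇒isK : ∀ x → Kset x → isK x ≡ true
Kset⇒isK x ∉J with isJ x in e
... | true  = contradiction (isJ⇒Jset x e) ∉J
... | false = refl

isK⇒Kset : ∀ x → isK x ≡ true → Kset x
isK⇒Kset x h ∈J = contradiction (trans (sym h) (cong not (Jset⇒isJ x ∈J))) λ ()

upTo-suc : ∀ n → upTo (suc n) ≡ upTo n ++ [ n ]
upTo-suc n = sym (upTo-∷ʳ n)

double double+1 : ℕ → ℕ
double   a = a + a
double+1 a = suc (a + a)

evensTo oddsTo : ℕ → List ℕ
evensTo a = map double (upTo a)
oddsTo  b = map double+1 (upTo b)

filterᵇ-↭ : {X : Set} (q : X → Bool) → ∀ xs → xs ↭ filterᵇ q xs ++ filterᵇ (not ∘ q) xs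
filterᵇ-↭ q []       = ↭.refl
filterᵇ-↭ q (x ∷ xs) with q x
... | true  = ↭.prep x (filterᵇ-↭ q xs)
... | false = ↭.trans (↭.prep x (filterᵇ-↭ q xs)) (↭.↭-sym (shift x (filterᵇ q xs) (filterᵇ (not ∘ q) xs)))

map-upTo-suc : {A : Set} (f : ℕ → A) → ∀ n → map f (upTo (suc n)) ≡ map f (upTo n) ++ [ f n ]
map-upTo-suc f n = trans (cong (map f) (upTo-suc n)) (map-++ f (upTo n) [ n ])

length-map-upTo : {X : Set} (f : ℕ → X) → ∀ n → length (map f (upTo n)) ≡ n
length-map-upTo f n = trans (length-map f (upTo n)) (length-upTo n)

length-snoc : {X : Set} (xs : List X) {x : X} {n : ℕ} → length xs ≡ n → length (xs ++ [ x ]) ≡ suc n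
length-snoc xs {x} e = trans (length-++ xs {[ x ]}) (trans (+-comm (length xs) 1) (cong suc e))

private
  filterᵇ-upTo-suc : (q : ℕ → Bool) → ∀ n → filterᵇ q (upTo (suc n)) ≡ filterᵇ q (upTo n) ++ filterᵇ q [ n ]
  filterᵇ-upTo-suc q n = trans (cong (filterᵇ q) (upTo-suc n)) (filter-++ (T? ∘ q) (upTo n) [ n ])

  upTo-double-suc : ∀ p → upTo (suc p + suc p) ≡ upTo (suc (suc (p + p)))
  upTo-double-suc p = cong (upTo ∘ suc) (+-suc p p)

evens-upTo-double   : ∀ p → filterᵇ isEven (upTo (p + p)) ≡ evensTo p
odds-upTo-double    : ∀ p → filterᵇ (not ∘ isEven) (upTo (p + p)) ≡ oddsTo p
evens-upTo-double+1 : ∀ p → filterᵇ isEven (upTo (suc (p + p))) ≡ evensTo (suc p)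
odds-upTo-double+1  : ∀ p → filterᵇ (not ∘ isEven) (upTo (suc (p + p))) ≡ oddsTo p

evens-upTo-double+1 p =
  trans (filterᵇ-upTo-suc isEven (p + p))
    (trans (cong₂ _++_ (evens-upTo-double p) (filterᵇ-accept isEven {p + p} {[]} (isEven-double p)))
      (sym (map-upTo-suc double p)))
odds-upTo-double+1 p =
  trans (filterᵇ-upTo-suc (not ∘ isEven) (p + p))
    (trans (cong₂ _++_ (odds-upTo-double p) (filterᵇ-reject (not ∘ isEven) {p + p} {[]} (cong not (isEven-double p))))
      (++-identityʳ (oddsTo p)))
evens-upTo-double zero    = refl
evens-upTo-double (suc p) =
  trans (cong (filterᵇ isEven) (upTo-double-suc p))
    (trans (filterᵇ-upTo-suc isEven (suc (p + p)))
      (trans (cong₂ _++_ (evens-upTo-double+1 p) (filterᵇ-reject isEven {suc (p + p)} {[]} (cong not (isEven-double p))))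
        (++-identityʳ (evensTo (suc p)))))
odds-upTo-double zero    = refl
odds-upTo-double (suc p) =
  trans (cong (filterᵇ (not ∘ isEven)) (upTo-double-suc p))
    (trans (filterᵇ-upTo-suc (not ∘ isEven) (suc (p + p)))
      (trans (cong₂ _++_ (odds-upTo-double+1 p)
                         (filterᵇ-accept (not ∘ isEven) {suc (p + p)} {[]} (trans (not-involutive _) (isEven-double p))))
        (sym (map-upTo-suc double+1 p))))

upTo-double-↭ : ∀ p → upTo (p + p) ↭ evensTo p ++ oddsTo p
upTo-double-↭ p = subst₂ (λ U V → upTo (p + p) ↭ U ++ V) (evens-upTo-double p) (odds-upTo-double p) (filterᵇ-↭ isEven _)

upTo-double+1-↭ : ∀ p → upTo (suc (p + p)) ↭ evensTo (suc p) ++ oddsTo p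
upTo-double+1-↭ p =
  subst₂ (λ U V → upTo (suc (p + p)) ↭ U ++ V) (evens-upTo-double+1 p) (odds-upTo-double+1 p) (filterᵇ-↭ isEven _)

map-upTo-cong : {A : Set} (f g : ℕ → A) → ∀ k → (∀ i → i < k → f i ≡ g i) → map f (upTo k) ≡ map g (upTo k)
map-upTo-cong f g zero    e = refl
map-upTo-cong f g (suc k) e =
  trans (map-upTo-suc f k)
    (trans (cong₂ _++_ (map-upTo-cong f g k (λ i i<k → e i (m<n⇒m<1+n i<k))) (cong [_] (e k (n<1+n k))))
      (sym (map-upTo-suc g k)))

replaceLast : {X : Set} → ℕ → (ℕ → X) → X → ℕ → X
replaceLast n f ℓ i with i ℕ.≟ n
... | yes _ = ℓ
... | no  _ = f i

map-replaceLast : {X : Set} (n : ℕ) (f : ℕ → X) (ℓ : X) → map (replaceLast n f ℓ) (upTo (suc n)) ≡ map f (upTo n) ++ [ ℓ ]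
map-replaceLast n f ℓ = trans (map-upTo-suc _ n) (cong₂ _++_ (map-upTo-cong _ f n interior) (cong [_] last))
  where
  interior : ∀ i → i < n → replaceLast n f ℓ i ≡ f i
  interior i i<n with i ℕ.≟ n
  ... | yes refl = contradiction i<n (<-irrefl refl)
  ... | no  _    = refl
  last : replaceLast n f ℓ n ≡ ℓ
  last with n ℕ.≟ n
  ... | yes _   = refl
  ... | no  n≢n = contradiction refl n≢n

-- All matrices of the argument are submatrices of a single table: columns are ordinary (indexed by ℕ)
-- or one extra column, and a row is a K- or J-Hankel row, possibly with a 1 in the extra column (⁺),
-- or one of a few auxiliary rows.
data Col : Set where
  col   : ℕ → Col
  extra : Col

data Row : Set where
  kRow kRow⁺ jRow jRow⁺ : ℕ → Row
  ones ones⁺ extraUnit evenRow oddRow : Row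

entry : Row → Col → Bool
entry (kRow i)  (col c) = isK (i + c)
entry (kRow i)  extra   = false
entry (kRow⁺ i) (col c) = isK (i + c)
entry (kRow⁺ i) extra   = true
entry (jRow i)  (col c) = isJ (i + c)
entry (jRow i)  extra   = false
entry (jRow⁺ i) (col c) = isJ (i + c)
entry (jRow⁺ i) extra   = true
entry ones      (col _) = true
entry ones      extra   = false
entry ones⁺     _       = true
entry extraUnit (col _) = false
entry extraUnit extra   = true
entry evenRow   (col c) = isEven c
entry evenRow   extra   = false
entry oddRow    (col c) = not (isEven c)
entry oddRow    extra   = false

jEntry : ℕ → ℕ → Bool
jEntry a b = isJ (a + b)

kEntry : ℕ → ℕ → Bool
kEntry a b = isK (a + b)

permanent-jRows : ∀ R C → permanent entry (map jRow R) (map col C) ≡ permanent jEntry R C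
permanent-jRows R C = trans (permanent-map-rows entry jRow R _) (permanent-map-cols _ col R C)

permanent-kRows : ∀ R C → permanent entry (map kRow R) (map col C) ≡ permanent kEntry R C
permanent-kRows R C = trans (permanent-map-rows entry kRow R _) (permanent-map-cols _ col R C)

permanent-kRows-even×odd : ∀ R C → permanent entry (map kRow (map double R)) (map col (map double+1 C)) ≡ permanent jEntry R C
permanent-kRows-even×odd R C =
  trans (permanent-kRows (map double R) (map double+1 C))
    (trans (permanent-map-rows _ double R _)
      (trans (permanent-map-cols _ double+1 R C) (permanent-cong isK-even+odd R C)))

permanent-kRows-odd×even : ∀ R C → permanent entry (map kRow (map double+1 R)) (map col (map double C)) ≡ permanent jEntry R C
permanent-kRows-odd×even R C =
  trans (permanent-kRows (map double+1 R) (map double C))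
    (trans (permanent-map-rows _ double+1 R _)
      (trans (permanent-map-cols _ double R C) (permanent-cong isK-odd+even R C)))

_≐_⊕_ : Row → Row → Row → Set
x ≐ y ⊕ z = ∀ c → entry x c ≡ entry y c xor entry z c

offset-map : (o : Row) (f g : ℕ → Row) → (∀ i → f i ≐ o ⊕ g i) → ∀ I → Offset entry o (map f I) (map g I)
offset-map o f g e []      = []
offset-map o f g e (i ∷ I) = e i ∷ offset-map o f g e I

jRow⁺≐extraUnit⊕jRow : ∀ i → jRow⁺ i ≐ extraUnit ⊕ jRow i
jRow⁺≐extraUnit⊕jRow i (col c) = refl
jRow⁺≐extraUnit⊕jRow i extra   = refl

jRow⁺≐ones⁺⊕kRow : ∀ i → jRow⁺ i ≐ ones⁺ ⊕ kRow i
jRow⁺≐ones⁺⊕kRow i (col c) = sym (not-involutive _)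
jRow⁺≐ones⁺⊕kRow i extra   = refl

kRow⁺≐extraUnit⊕kRow : ∀ i → kRow⁺ i ≐ extraUnit ⊕ kRow i
kRow⁺≐extraUnit⊕kRow i (col c) = refl
kRow⁺≐extraUnit⊕kRow i extra   = refl

kRow⁺≐ones⁺⊕jRow : ∀ i → kRow⁺ i ≐ ones⁺ ⊕ jRow i
kRow⁺≐ones⁺⊕jRow i (col c) = refl
kRow⁺≐ones⁺⊕jRow i extra   = refl

jRow≐ones⊕kRow : ∀ i → jRow i ≐ ones ⊕ kRow i
jRow≐ones⊕kRow i (col c) = sym (not-involutive _)
jRow≐ones⊕kRow i extra   = refl

ones⁺≐extraUnit⊕ones : ones⁺ ≐ extraUnit ⊕ ones
ones⁺≐extraUnit⊕ones (col c) = refl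
ones⁺≐extraUnit⊕ones extra   = refl

ones≐evenRow⊕oddRow : ones ≐ evenRow ⊕ oddRow
ones≐evenRow⊕oddRow (col c) with isEven c
... | true  = refl
... | false = refl
ones≐evenRow⊕oddRow extra   = refl

withExtra : List ℕ → List Col
withExtra C = map col C ++ [ extra ]

isExtra : Col → Bool
isExtra extra   = true
isExtra (col _) = false

hasExtra : Row → Bool
hasExtra r = entry r extra

NoExtra : Row → Set
NoExtra r = hasExtra r ≡ false

private
  filterᵇ-isExtra : ∀ C → filterᵇ isExtra (withExtra C) ≡ [ extra ]
  filterᵇ-isExtra []      = refl
  filterᵇ-isExtra (c ∷ C) = filterᵇ-isExtra C

  filterᵇ-notExtra : ∀ C → filterᵇ (not ∘ isExtra) (withExtra C) ≡ map col C
  filterᵇ-notExtra []      = refl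
  filterᵇ-notExtra (c ∷ C) = cong (col c ∷_) (filterᵇ-notExtra C)

  noExtra-supported : ∀ {R} → All NoExtra R → All (SupportedIn entry isExtra hasExtra) R
  noExtra-supported []                = []
  noExtra-supported {r ∷ _} (e ∷ es) = supported ∷ noExtra-supported es
    where
    supported : SupportedIn entry isExtra hasExtra r
    supported (col c) _ = sym e
    supported extra   h = contradiction (trans (sym h) e) λ ()

  extraUnit-supported : SupportedIn entry isExtra hasExtra extraUnit
  extraUnit-supported extra _ = refl

permanent-withExtra : ∀ {R} → All (SupportedIn entry isExtra hasExtra) R → ∀ C →
  permanent entry R (withExtra C) ≡
  permanent entry (filterᵇ hasExtra R) [ extra ] ∧ permanent entry (filterᵇ (not ∘ hasExtra) R) (map col C)
permanent-withExtra {R} s C =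
  trans (permanent-blockDiagonal entry isExtra hasExtra s (withExtra C))
    (cong₂ (λ U V → permanent entry (filterᵇ hasExtra R) U ∧ permanent entry (filterᵇ (not ∘ hasExtra) R) V)
      (filterᵇ-isExtra C) (filterᵇ-notExtra C))

permanent-noExtra : ∀ {R} → All NoExtra R → ∀ C → permanent entry R (withExtra C) ≡ false
permanent-noExtra {R} n C =
  trans (permanent-withExtra (noExtra-supported n) C)
    (cong (λ U → permanent entry U [ extra ] ∧ permanent entry (filterᵇ (not ∘ hasExtra) R) (map col C)) (filterᵇ-none hasExtra n))

permanent-extraUnit∷ : ∀ {R} → All NoExtra R → ∀ C → permanent entry (extraUnit ∷ R) (withExtra C) ≡ permanent entry R (map col C)
permanent-extraUnit∷ {R} n C =
  trans (permanent-withExtra (_∷_ {x = extraUnit} extraUnit-supported (noExtra-supported n)) C)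
    (cong₂ (λ U V → permanent entry (extraUnit ∷ U) [ extra ] ∧ permanent entry V (map col C))
      (filterᵇ-none hasExtra n) (filterᵇ-all (not ∘ hasExtra) (All.map (cong not) n)))

xorSum-replaceOne-extraUnit : ∀ {Y} → All NoExtra Y → ∀ C →
  xorSum (λ L → permanent entry L (withExtra C)) (replaceOne extraUnit Y) ≡ xorSum (λ (_ , R) → permanent entry R (map col C)) (select Y)
xorSum-replaceOne-extraUnit {Y} n C =
  trans (xorSum-cong-All (λ L s → permanent-withExtra s C) (replaceOne-All _ {extraUnit} extraUnit-supported (noExtra-supported n)))
    (xorSum-replaceOne-partition-newˡ hasExtra (λ U V → permanent entry U [ extra ] ∧ permanent entry V (map col C)) n refl)

xorSum-replaceOne-ones : ∀ {Y} → All NoExtra Y → ∀ C → xorSum (λ L → permanent entry L (withExtra C)) (replaceOne ones Y) ≡ false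
xorSum-replaceOne-ones {Y} n C =
  trans (xorSum-cong-All (λ L nL → permanent-noExtra nL C) (replaceOne-All NoExtra refl n)) (xorSum-false (replaceOne ones Y))

permanent-extraUnit-offset : (f g : ℕ → Row) → (∀ i → f i ≐ extraUnit ⊕ g i) → (∀ i → NoExtra (g i)) → ∀ I C →
  permanent entry (map f I) (withExtra C) ≡ xorSum (λ (_ , R) → permanent entry R (map col C)) (select (map g I))
permanent-extraUnit-offset f g e n I C =
  trans (permanent-offset entry (offset-map extraUnit f g e I) [] (withExtra C))
    (cong₂ _xor_ (permanent-noExtra (map⁺ (universal n I)) C) (xorSum-replaceOne-extraUnit (map⁺ (universal n I)) C))

permanent-ones⁺-offset : (f g : ℕ → Row) → (∀ i → f i ≐ ones⁺ ⊕ g i) → (∀ i → NoExtra (g i)) → ∀ I C →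
  permanent entry (map f I) (withExtra C) ≡ xorSum (λ (_ , R) → permanent entry R (map col C)) (select (map g I))
permanent-ones⁺-offset f g e n I C =
  trans (permanent-offset entry (offset-map ones⁺ f g e I) [] (withExtra C))
    (trans (cong₂ _xor_ (permanent-noExtra nY C)
             (trans (xorSum-replaceOne-linear (λ L → permanent entry L (withExtra C))
                      (λ P S → permanent-linear entry ones⁺ extraUnit ones ones⁺≐extraUnit⊕ones P S (withExtra C)) Y)
               (cong₂ _xor_ (xorSum-replaceOne-extraUnit nY C) (xorSum-replaceOne-ones nY C))))
      (xor-identityʳ _))
  where
  Y : List Row
  Y = map g I
  nY : All NoExtra Y
  nY = map⁺ (universal n I)

isOddCol : Col → Bool
isOddCol (col c) = not (isEven c)
isOddCol extra   = false

-- K contains only odd numbers, so the K-row of an even index meets only odd columns.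
inOddCols : Row → Bool
inOddCols (kRow i) = isEven i
inOddCols oddRow   = true
inOddCols _        = false

ParitySupported : Row → Set
ParitySupported = SupportedIn entry isOddCol inOddCols

kRow-paritySupported : ∀ i → ParitySupported (kRow i)
kRow-paritySupported i (col c) h = isK-support i c h

evenRow-paritySupported : ParitySupported evenRow
evenRow-paritySupported (col c) h rewrite h = refl

oddRow-paritySupported : ParitySupported oddRow
oddRow-paritySupported (col c) h = h

oddCols evenCols : List ℕ → List Col
oddCols  C = map col (filterᵇ (not ∘ isEven) C)
evenCols C = map col (filterᵇ isEven C)

permanent-parityBlocks : ∀ {R} → All ParitySupported R → ∀ C →
  permanent entry R (map col C) ≡
  permanent entry (filterᵇ inOddCols R) (oddCols C) ∧ permanent entry (filterᵇ (not ∘ inOddCols) R) (evenCols C)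
permanent-parityBlocks {R} s C =
  trans (permanent-blockDiagonal entry isOddCol inOddCols s (map col C))
    (cong₂ (λ U V → permanent entry (filterᵇ inOddCols R) U ∧ permanent entry (filterᵇ (not ∘ inOddCols) R) V)
      (filterᵇ-map isOddCol col C)
      (trans (filterᵇ-map (not ∘ isOddCol) col C) (cong (map col) (filterᵇ-cong (λ c → not-involutive (isEven c)) C))))

permanent-parityBlocks-++ : ∀ {L Z} → All ParitySupported L → All ParitySupported Z → ∀ C →
  permanent entry (L ++ Z) (map col C) ≡
  permanent entry (filterᵇ inOddCols L ++ filterᵇ inOddCols Z) (oddCols C) ∧
  permanent entry (filterᵇ (not ∘ inOddCols) L ++ filterᵇ (not ∘ inOddCols) Z) (evenCols C)
permanent-parityBlocks-++ {L} {Z} sL sZ C =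
  trans (permanent-parityBlocks (++⁺ sL sZ) C)
    (cong₂ (λ U V → permanent entry U (oddCols C) ∧ permanent entry V (evenCols C))
      (filter-++ (T? ∘ inOddCols) L Z) (filter-++ (T? ∘ (not ∘ inOddCols)) L Z))

kEvens kOdds : ℕ → List Row
kEvens a = map kRow (evensTo a)
kOdds  b = map kRow (oddsTo b)

kEvens-inOddCols : ∀ a → All (λ r → inOddCols r ≡ true) (kEvens a)
kEvens-inOddCols a = map⁺ (map⁺ (universal isEven-double (upTo a)))

kOdds-inEvenCols : ∀ b → All (λ r → inOddCols r ≡ false) (kOdds b)
kOdds-inEvenCols b = map⁺ (map⁺ (universal (cong not ∘ isEven-double) (upTo b)))

kRows-paritySupported : ∀ I → All ParitySupported (map kRow I)
kRows-paritySupported I = map⁺ (universal kRow-paritySupported I)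

-- Hankel permanents

-- Writing each J-row as the all-ones row plus a K-row, and the all-ones row as evenRow ⊕ oddRow,
-- splits the J-Hankel permanent on the rows 0,2,… ,1,3,… into five products of parity blocks.
module JRowsByParity (a b : ℕ) (C : List ℕ) where

  private
    KE KO : List Row
    KE = kEvens a
    KO = kOdds b
    Co Ce : List Col
    Co = oddCols C
    Ce = evenCols C

    KE-odd : All (λ r → inOddCols r ≡ true) KE
    KE-odd = kEvens-inOddCols a
    KO-even : All (λ r → inOddCols r ≡ false) KO
    KO-even = kOdds-inEvenCols b

    KE-supported : All ParitySupported KE
    KE-supported = kRows-paritySupported (evensTo a)
    KO-supported : All ParitySupported KO
    KO-supported = kRows-paritySupported (oddsTo b)

    odd-KE : filterᵇ inOddCols KE ≡ KE
    odd-KE = filterᵇ-all inOddCols KE-odd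
    even-KE : filterᵇ (not ∘ inOddCols) KE ≡ []
    even-KE = filterᵇ-none (not ∘ inOddCols) (All.map (cong not) KE-odd)
    odd-KO : filterᵇ inOddCols KO ≡ []
    odd-KO = filterᵇ-none inOddCols KO-even
    even-KO : filterᵇ (not ∘ inOddCols) KO ≡ KO
    even-KO = filterᵇ-all (not ∘ inOddCols) (All.map (cong not) KO-even)

  unreplaced kEvenByEvenRow kEvenByOddRow kOddByEvenRow kOddByOddRow : Bool
  unreplaced     = permanent entry KE Co ∧ permanent entry KO Ce
  kEvenByEvenRow = xorSum (λ (_ , R) → permanent entry R Co ∧ permanent entry (evenRow ∷ KO) Ce) (select KE)
  kEvenByOddRow  = xorSum (λ L → permanent entry L Co ∧ permanent entry KO Ce) (replaceOne oddRow KE)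
  kOddByEvenRow  = xorSum (λ L → permanent entry KE Co ∧ permanent entry L Ce) (replaceOne evenRow KO)
  kOddByOddRow   = xorSum (λ (_ , R) → permanent entry (KE ++ [ oddRow ]) Co ∧ permanent entry R Ce) (select KO)

  private
    withKO withKE : List Row → List Row → Bool
    withKO U V = permanent entry (U ++ filterᵇ inOddCols KO) Co ∧ permanent entry (V ++ filterᵇ (not ∘ inOddCols) KO) Ce
    withKE U V = permanent entry (filterᵇ inOddCols KE ++ U) Co ∧ permanent entry (filterᵇ (not ∘ inOddCols) KE ++ V) Ce

    replacedKE : ∀ {y} → ParitySupported y →
      xorSum (λ L → permanent entry (L ++ KO) (map col C)) (replaceOne y KE) ≡
      xorSum (λ L → withKO (filterᵇ inOddCols L) (filterᵇ (not ∘ inOddCols) L)) (replaceOne y KE)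
    replacedKE sy = xorSum-cong-All (λ L sL → permanent-parityBlocks-++ sL KO-supported C) (replaceOne-All _ sy KE-supported)

    replacedKO : ∀ {y} → ParitySupported y →
      xorSum (λ L → permanent entry (KE ++ L) (map col C)) (replaceOne y KO) ≡
      xorSum (λ L → withKE (filterᵇ inOddCols L) (filterᵇ (not ∘ inOddCols) L)) (replaceOne y KO)
    replacedKO sy = xorSum-cong-All (λ L sL → permanent-parityBlocks-++ KE-supported sL C) (replaceOne-All _ sy KO-supported)

    unreplaced-eq : permanent entry (KE ++ KO) (map col C) ≡ unreplaced
    unreplaced-eq = trans (permanent-parityBlocks-++ KE-supported KO-supported C)
      (cong₂ (λ U V → permanent entry U Co ∧ permanent entry V Ce)
        (trans (cong₂ _++_ odd-KE odd-KO) (++-identityʳ KE)) (cong₂ _++_ even-KE even-KO))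

    kEvenByEvenRow-eq : xorSum (λ L → permanent entry (L ++ KO) (map col C)) (replaceOne evenRow KE) ≡ kEvenByEvenRow
    kEvenByEvenRow-eq =
      trans (replacedKE evenRow-paritySupported)
        (trans (xorSum-replaceOne-partition-newʳ inOddCols withKO KE-odd refl)
          (xorSum-cong (λ (_ , R) → cong₂ (λ U V → permanent entry U Co ∧ permanent entry (evenRow ∷ V) Ce)
                                      (trans (cong (R ++_) odd-KO) (++-identityʳ R)) even-KO) (select KE)))

    kEvenByOddRow-eq : xorSum (λ L → permanent entry (L ++ KO) (map col C)) (replaceOne oddRow KE) ≡ kEvenByOddRow
    kEvenByOddRow-eq =
      trans (replacedKE oddRow-paritySupported)
        (trans (xorSum-replaceOne-partition-allˡ inOddCols withKO KE-odd refl)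
          (xorSum-cong (λ L → cong₂ (λ U V → permanent entry U Co ∧ permanent entry V Ce)
                               (trans (cong (L ++_) odd-KO) (++-identityʳ L)) even-KO) (replaceOne oddRow KE)))

    kOddByEvenRow-eq : xorSum (λ L → permanent entry (KE ++ L) (map col C)) (replaceOne evenRow KO) ≡ kOddByEvenRow
    kOddByEvenRow-eq =
      trans (replacedKO evenRow-paritySupported)
        (trans (xorSum-replaceOne-partition-allʳ inOddCols withKE KO-even refl)
          (xorSum-cong (λ L → cong₂ (λ U V → permanent entry U Co ∧ permanent entry V Ce)
                               (trans (cong (_++ []) odd-KE) (++-identityʳ KE)) (cong (_++ L) even-KE)) (replaceOne evenRow KO)))

    kOddByOddRow-eq : xorSum (λ L → permanent entry (KE ++ L) (map col C)) (replaceOne oddRow KO) ≡ kOddByOddRow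
    kOddByOddRow-eq =
      trans (replacedKO oddRow-paritySupported)
        (trans (xorSum-replaceOne-partition-newˡ inOddCols withKE KO-even refl)
          (xorSum-cong (λ (_ , R) → cong₂ (λ U V → permanent entry (U ++ [ oddRow ]) Co ∧ permanent entry V Ce)
                                      odd-KE (cong (_++ R) even-KE)) (select KO)))

  permanent-jRows-byParity : permanent entry (map jRow (evensTo a ++ oddsTo b)) (map col C) ≡
    unreplaced xor ((kEvenByEvenRow xor kEvenByOddRow) xor (kOddByEvenRow xor kOddByOddRow))
  permanent-jRows-byParity =
    trans (permanent-offset entry (offset-map ones jRow kRow jRow≐ones⊕kRow (evensTo a ++ oddsTo b)) [] (map col C))
      (trans (cong (λ Y → permanent entry Y (map col C) xor xorSum (λ L → permanent entry L (map col C)) (replaceOne ones Y))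
                   (map-++ kRow (evensTo a) (oddsTo b)))
        (cong₂ _xor_ unreplaced-eq
          (trans (xorSum-replaceOne-++ (λ L → permanent entry L (map col C)) ones KE KO)
            (cong₂ _xor_
              (trans (xorSum-replaceOne-linear (λ L → permanent entry (L ++ KO) (map col C)) (linearˡ evenRow oddRow ones≐evenRow⊕oddRow) KE)
                (cong₂ _xor_ kEvenByEvenRow-eq kEvenByOddRow-eq))
              (trans (xorSum-replaceOne-linear (λ L → permanent entry (KE ++ L) (map col C)) (linearʳ evenRow oddRow ones≐evenRow⊕oddRow) KO)
                (cong₂ _xor_ kOddByEvenRow-eq kOddByOddRow-eq))))))
    where
    linearˡ : ∀ o₁ o₂ → ones ≐ o₁ ⊕ o₂ → ∀ P S →
      permanent entry ((P ++ ones ∷ S) ++ KO) (map col C) ≡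
      permanent entry ((P ++ o₁ ∷ S) ++ KO) (map col C) xor permanent entry ((P ++ o₂ ∷ S) ++ KO) (map col C)
    linearˡ o₁ o₂ e P S rewrite ++-assoc P (ones ∷ S) KO | ++-assoc P (o₁ ∷ S) KO | ++-assoc P (o₂ ∷ S) KO =
      permanent-linear entry ones o₁ o₂ e P (S ++ KO) (map col C)
    linearʳ : ∀ o₁ o₂ → ones ≐ o₁ ⊕ o₂ → ∀ P S →
      permanent entry (KE ++ P ++ ones ∷ S) (map col C) ≡
      permanent entry (KE ++ P ++ o₁ ∷ S) (map col C) xor permanent entry (KE ++ P ++ o₂ ∷ S) (map col C)
    linearʳ o₁ o₂ e P S
      rewrite sym (++-assoc KE P (ones ∷ S)) | sym (++-assoc KE P (o₁ ∷ S)) | sym (++-assoc KE P (o₂ ∷ S)) =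
      permanent-linear entry ones o₁ o₂ e (KE ++ P) S (map col C)

jHankel : ℕ → Bool
jHankel q = permanent jEntry (upTo q) (upTo q)

jMinorSum : ℕ → Bool
jMinorSum n = xorSum (λ (_ , R) → permanent jEntry R (upTo n)) (select (upTo (suc n)))

jOrOnes : Maybe ℕ → ℕ → Bool
jOrOnes nothing  _ = true
jOrOnes (just a) b = isJ (a + b)

-- Both cross terms of the expansion of jHankel (p + p) reduce to this value, so they cancel.
onesReplacedJ : ℕ → Bool
onesReplacedJ p = xorSum (λ L → permanent jOrOnes L (upTo p)) (replaceOne nothing (map just (upTo p)))

permanent-jEntry-sym : ∀ R C → permanent jEntry R C ≡ permanent jEntry C R
permanent-jEntry-sym R C = trans (permanent-transpose jEntry R C) (permanent-cong (λ a b → cong isJ (+-comm b a)) C R)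

kEvens-oddRow-replaced : ∀ p →
  xorSum (λ L → permanent entry L (map col (oddsTo p))) (replaceOne oddRow (kEvens p)) ≡ onesReplacedJ p
kEvens-oddRow-replaced p =
  trans (cong (λ Y → xorSum (λ L → permanent entry L (map col (oddsTo p))) (replaceOne oddRow Y)) (relabel (upTo p)))
    (trans (xorSum-replaceOne-map row _ nothing (map just (upTo p)))
      (xorSum-cong (λ L → trans (permanent-map-rows entry row L _)
                            (trans (permanent-map-cols _ col L _)
                              (trans (permanent-map-cols _ double+1 L (upTo p)) (permanent-cong entries L (upTo p)))))
                   (replaceOne nothing (map just (upTo p)))))
  where
  row : Maybe ℕ → Row
  row nothing  = oddRow
  row (just a) = kRow (double a)
  relabel : ∀ R → map kRow (map double R) ≡ map row (map just R)
  relabel []      = refl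
  relabel (a ∷ R) = cong (kRow (double a) ∷_) (relabel R)
  entries : ∀ r c → entry (row r) (col (double+1 c)) ≡ jOrOnes r c
  entries nothing  c = trans (not-involutive _) (isEven-double c)
  entries (just a) c = isK-even+odd a c

kOdds-evenRow-replaced : ∀ p →
  xorSum (λ L → permanent entry L (map col (evensTo p))) (replaceOne evenRow (kOdds p)) ≡ onesReplacedJ p
kOdds-evenRow-replaced p =
  trans (cong (λ Y → xorSum (λ L → permanent entry L (map col (evensTo p))) (replaceOne evenRow Y)) (relabel (upTo p)))
    (trans (xorSum-replaceOne-map row _ nothing (map just (upTo p)))
      (xorSum-cong (λ L → trans (permanent-map-rows entry row L _)
                            (trans (permanent-map-cols _ col L _)
                              (trans (permanent-map-cols _ double L (upTo p)) (permanent-cong entries L (upTo p)))))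
                   (replaceOne nothing (map just (upTo p)))))
  where
  row : Maybe ℕ → Row
  row nothing  = evenRow
  row (just b) = kRow (double+1 b)
  relabel : ∀ R → map kRow (map double+1 R) ≡ map row (map just R)
  relabel []      = refl
  relabel (b ∷ R) = cong (kRow (double+1 b) ∷_) (relabel R)
  entries : ∀ r c → entry (row r) (col (double c)) ≡ jOrOnes r c
  entries nothing  c = isEven-double c
  entries (just b) c = isK-odd+even b c

length-kEvens : ∀ a → length (kEvens a) ≡ a
length-kEvens a = trans (length-map kRow (evensTo a)) (length-map-upTo double a)

length-col-oddsTo : ∀ b → length (map col (oddsTo b)) ≡ b
length-col-oddsTo b = trans (length-map col (oddsTo b)) (length-map-upTo double+1 b)

kEvens-too-long : ∀ p → permanent entry (kEvens (suc p)) (map col (oddsTo p)) ≡ false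
kEvens-too-long p = permanent-mismatch entry (kEvens (suc p)) (map col (oddsTo p)) (length-kEvens (suc p)) (length-col-oddsTo p) 1+n≢n

jHankel-double : ∀ p → jHankel (p + p) ≡ jHankel p
jHankel-double p =
  trans (sym (permanent-jRows (upTo (p + p)) (upTo (p + p))))
    (trans (permanent-↭ entry (↭-map⁺ jRow (upTo-double-↭ p)) (map col (upTo (p + p))))
      (trans permanent-jRows-byParity
        (trans (cong₂ _xor_ unreplaced-eq (cong₂ _xor_ (cong₂ _xor_ evenByEven-eq evenByOdd-eq) (cong₂ _xor_ oddByEven-eq oddByOdd-eq)))
          (collect (jHankel p) (onesReplacedJ p)))))
  where
  open JRowsByParity p p (upTo (p + p))
  odds : oddCols (upTo (p + p)) ≡ map col (oddsTo p)
  odds = cong (map col) (odds-upTo-double p)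
  evens : evenCols (upTo (p + p)) ≡ map col (evensTo p)
  evens = cong (map col) (evens-upTo-double p)
  KE-block : permanent entry (kEvens p) (map col (oddsTo p)) ≡ jHankel p
  KE-block = permanent-kRows-even×odd (upTo p) (upTo p)
  KO-block : permanent entry (kOdds p) (map col (evensTo p)) ≡ jHankel p
  KO-block = permanent-kRows-odd×even (upTo p) (upTo p)
  unreplaced-eq : unreplaced ≡ jHankel p ∧ jHankel p
  unreplaced-eq = cong₂ _∧_ (trans (cong (permanent entry (kEvens p)) odds) KE-block)
                            (trans (cong (permanent entry (kOdds p)) evens) KO-block)
  evenByEven-eq : kEvenByEvenRow ≡ false
  evenByEven-eq =
    trans (xorSum-cong-All (λ (_ , R) eR → trans (cong (λ U → permanent entry R U ∧ evenBlock) odds)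
                                           (cong (_∧ evenBlock) (permanent-mismatch entry R (map col (oddsTo p)) refl (length-col-oddsTo p)
                                             (λ e → 1+n≢n (trans (sym (cong suc e)) (trans eR (length-kEvens p)))))))
                           (select-length (kEvens p)))
      (xorSum-false (select (kEvens p)))
    where
    evenBlock : Bool
    evenBlock = permanent entry (evenRow ∷ kOdds p) (evenCols (upTo (p + p)))
  evenByOdd-eq : kEvenByOddRow ≡ onesReplacedJ p ∧ jHankel p
  evenByOdd-eq =
    trans (sym (∧-distribʳ-xorSum _ (λ L → permanent entry L (oddCols (upTo (p + p)))) (replaceOne oddRow (kEvens p))))
      (cong₂ _∧_ (trans (cong (λ U → xorSum (λ L → permanent entry L U) (replaceOne oddRow (kEvens p))) odds)
                        (kEvens-oddRow-replaced p))
                 (trans (cong (permanent entry (kOdds p)) evens) KO-block))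
  oddByEven-eq : kOddByEvenRow ≡ jHankel p ∧ onesReplacedJ p
  oddByEven-eq =
    trans (sym (∧-distribˡ-xorSum _ (λ L → permanent entry L (evenCols (upTo (p + p)))) (replaceOne evenRow (kOdds p))))
      (cong₂ _∧_ (trans (cong (permanent entry (kEvens p)) odds) KE-block)
                 (trans (cong (λ U → xorSum (λ L → permanent entry L U) (replaceOne evenRow (kOdds p))) evens)
                        (kOdds-evenRow-replaced p)))
  oddByOdd-eq : kOddByOddRow ≡ false
  oddByOdd-eq =
    trans (xorSum-cong (λ (_ , R) → cong (_∧ permanent entry R (evenCols (upTo (p + p))))
                                     (trans (cong (permanent entry (kEvens p ++ [ oddRow ])) odds)
                                       (permanent-mismatch entry (kEvens p ++ [ oddRow ]) (map col (oddsTo p))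
                                         (length-snoc (kEvens p) (length-kEvens p))
                                         (length-col-oddsTo p) 1+n≢n)))
                       (select (kOdds p)))
      (xorSum-false (select (kOdds p)))
  collect : ∀ j w → (j ∧ j) xor ((false xor (w ∧ j)) xor ((j ∧ w) xor false)) ≡ j
  collect true  true  = refl
  collect true  false = refl
  collect false true  = refl
  collect false false = refl

private
  xorSum-select-map² : {X : Set} (f : ℕ → X) (g : ℕ → ℕ) (F : X × List X → Bool) (R : List ℕ) →
    xorSum F (select (map f (map g R))) ≡ xorSum (λ (r , R′) → F (f (g r) , map f (map g R′))) (select R)
  xorSum-select-map² f g F R = trans (xorSum-select-map f F (map g R)) (xorSum-select-map g _ R)

kEvens-minorSum : ∀ p → xorSum (λ (_ , R) → permanent entry R (map col (oddsTo p))) (select (kEvens (suc p))) ≡ jMinorSum p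
kEvens-minorSum p =
  trans (xorSum-select-map² kRow double (λ (_ , R) → permanent entry R (map col (oddsTo p))) (upTo (suc p)))
    (xorSum-cong (λ (_ , R) → permanent-kRows-even×odd R (upTo p)) (select (upTo (suc p))))

evenRow∷kOdds : ∀ p → permanent entry (evenRow ∷ kOdds p) (map col (evensTo (suc p))) ≡ jMinorSum p
evenRow∷kOdds p =
  trans (xorSum-select-map² col double (λ (c , C) → entry evenRow c ∧ permanent entry (kOdds p) C) (upTo (suc p)))
    (xorSum-cong (λ (c , C) → trans (cong (_∧ permanent entry (kOdds p) (map col (map double C))) (isEven-double c))
                                (trans (permanent-kRows-odd×even (upTo p) C) (permanent-jEntry-sym (upTo p) C)))
                 (select (upTo (suc p))))

jHankel-double+1 : ∀ p → jHankel (suc (p + p)) ≡ jMinorSum p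
jHankel-double+1 p =
  trans (sym (permanent-jRows (upTo (suc (p + p))) (upTo (suc (p + p)))))
    (trans (permanent-↭ entry (↭-map⁺ jRow (upTo-double+1-↭ p)) (map col (upTo (suc (p + p)))))
      (trans permanent-jRows-byParity
        (trans (cong₂ _xor_ unreplaced-eq (cong₂ _xor_ (cong₂ _xor_ evenByEven-eq evenByOdd-eq) (cong₂ _xor_ oddByEven-eq oddByOdd-eq)))
          (collect (jMinorSum p)))))
  where
  open JRowsByParity (suc p) p (upTo (suc (p + p)))
  odds : oddCols (upTo (suc (p + p))) ≡ map col (oddsTo p)
  odds = cong (map col) (odds-upTo-double+1 p)
  evens : evenCols (upTo (suc (p + p))) ≡ map col (evensTo (suc p))
  evens = cong (map col) (evens-upTo-double+1 p)
  tooManyRows : ∀ R → length R ≡ suc p → permanent entry R (oddCols (upTo (suc (p + p)))) ≡ false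
  tooManyRows R eR = trans (cong (permanent entry R) odds) (permanent-mismatch entry R _ eR (length-col-oddsTo p) 1+n≢n)
  unreplaced-eq : unreplaced ≡ false
  unreplaced-eq = cong (_∧ permanent entry (kOdds p) (evenCols (upTo (suc (p + p)))))
                       (tooManyRows (kEvens (suc p)) (length-kEvens (suc p)))
  evenByEven-eq : kEvenByEvenRow ≡ jMinorSum p
  evenByEven-eq =
    trans (sym (∧-distribʳ-xorSum _ (λ (_ , R) → permanent entry R (oddCols (upTo (suc (p + p))))) (select (kEvens (suc p)))))
      (trans (cong₂ _∧_ (trans (cong (λ U → xorSum (λ (_ , R) → permanent entry R U) (select (kEvens (suc p)))) odds)
                               (kEvens-minorSum p))
                        (trans (cong (permanent entry (evenRow ∷ kOdds p)) evens) (evenRow∷kOdds p)))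
        (∧-idem (jMinorSum p)))
  evenByOdd-eq : kEvenByOddRow ≡ false
  evenByOdd-eq =
    trans (xorSum-cong-All (λ L eL → cong (_∧ permanent entry (kOdds p) (evenCols (upTo (suc (p + p)))))
                                          (tooManyRows L (trans eL (length-kEvens (suc p)))))
                           (replaceOne-length oddRow (kEvens (suc p))))
      (xorSum-false (replaceOne oddRow (kEvens (suc p))))
  oddByEven-eq : kOddByEvenRow ≡ false
  oddByEven-eq =
    trans (xorSum-cong (λ L → cong (_∧ permanent entry L (evenCols (upTo (suc (p + p)))))
                                  (tooManyRows (kEvens (suc p)) (length-kEvens (suc p))))
                       (replaceOne evenRow (kOdds p)))
      (xorSum-false (replaceOne evenRow (kOdds p)))
  oddByOdd-eq : kOddByOddRow ≡ false
  oddByOdd-eq =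
    trans (xorSum-cong (λ (_ , R) → cong (_∧ permanent entry R (evenCols (upTo (suc (p + p)))))
                         (trans (cong (permanent entry (kEvens (suc p) ++ [ oddRow ])) odds)
                           (permanent-mismatch entry (kEvens (suc p) ++ [ oddRow ]) (map col (oddsTo p))
                             (length-snoc (kEvens (suc p)) (length-kEvens (suc p))) (length-col-oddsTo p)
                             (>⇒≢ (s≤s (n≤1+n p))))))
                       (select (kOdds p)))
      (xorSum-false (select (kOdds p)))
  collect : ∀ s → false xor ((s xor false) xor (false xor false)) ≡ s
  collect true  = refl
  collect false = refl

jBordered : ℕ → Bool
jBordered n = permanent entry (map jRow⁺ (upTo (suc n))) (withExtra (upTo n))

jBordered≡jMinorSum : ∀ n → jBordered n ≡ jMinorSum n
jBordered≡jMinorSum n =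
  trans (permanent-extraUnit-offset jRow⁺ jRow jRow⁺≐extraUnit⊕jRow (λ _ → refl) (upTo (suc n)) (upTo n))
    (trans (xorSum-select-map jRow (λ (_ , R) → permanent entry R (map col (upTo n))) (upTo (suc n)))
      (xorSum-cong (λ (_ , R) → permanent-jRows R (upTo n)) (select (upTo (suc n)))))

permanent-jRows⁺-byParity : ∀ a b C →
  permanent entry (map jRow⁺ (evensTo a ++ oddsTo b)) (withExtra C) ≡
  (xorSum (λ (_ , R) → permanent entry R (oddCols C)) (select (kEvens a)) ∧ permanent entry (kOdds b) (evenCols C)) xor
  (permanent entry (kEvens a) (oddCols C) ∧ xorSum (λ (_ , R) → permanent entry R (evenCols C)) (select (kOdds b)))
permanent-jRows⁺-byParity a b C =
  trans (permanent-ones⁺-offset jRow⁺ kRow jRow⁺≐ones⁺⊕kRow (λ _ → refl) (evensTo a ++ oddsTo b) C)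
    (trans (cong (λ Y → xorSum (λ (_ , R) → permanent entry R (map col C)) (select Y)) (map-++ kRow (evensTo a) (oddsTo b)))
      (trans (xorSum-select-++ (λ (_ , R) → permanent entry R (map col C)) (kEvens a) (kOdds b))
        (cong₂ _xor_
          (trans (xorSum-cong-All (λ (_ , R) (_ , oddR) → dropFromEvens R oddR) (select-All _ evens))
                 (sym (∧-distribʳ-xorSum _ (λ (_ , R) → permanent entry R (oddCols C)) (select (kEvens a)))))
          (trans (xorSum-cong-All (λ (_ , R) (_ , evenR) → dropFromOdds R evenR) (select-All _ odds))
                 (sym (∧-distribˡ-xorSum _ (λ (_ , R) → permanent entry R (evenCols C)) (select (kOdds b))))))))
  where
  InOdd InEven : Row → Set
  InOdd  r = (inOddCols r ≡ true) × ParitySupported r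
  InEven r = (inOddCols r ≡ false) × ParitySupported r
  evens : All InOdd (kEvens a)
  evens = All.zip (kEvens-inOddCols a , kRows-paritySupported (evensTo a))
  odds : All InEven (kOdds b)
  odds = All.zip (kOdds-inEvenCols b , kRows-paritySupported (oddsTo b))
  dropFromEvens : ∀ R → All InOdd R →
    permanent entry (R ++ kOdds b) (map col C) ≡ permanent entry R (oddCols C) ∧ permanent entry (kOdds b) (evenCols C)
  dropFromEvens R oddR =
    trans (permanent-parityBlocks-++ (All.map proj₂ oddR) (kRows-paritySupported (oddsTo b)) C)
      (cong₂ (λ U V → permanent entry U (oddCols C) ∧ permanent entry V (evenCols C))
        (trans (cong₂ _++_ (filterᵇ-all inOddCols (All.map proj₁ oddR)) (filterᵇ-none inOddCols (kOdds-inEvenCols b)))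
               (++-identityʳ R))
        (cong₂ _++_ (filterᵇ-none (not ∘ inOddCols) (All.map (cong not ∘ proj₁) oddR))
                    (filterᵇ-all (not ∘ inOddCols) (All.map (cong not) (kOdds-inEvenCols b)))))
  dropFromOdds : ∀ R → All InEven R →
    permanent entry (kEvens a ++ R) (map col C) ≡ permanent entry (kEvens a) (oddCols C) ∧ permanent entry R (evenCols C)
  dropFromOdds R evenR =
    trans (permanent-parityBlocks-++ (kRows-paritySupported (evensTo a)) (All.map proj₂ evenR) C)
      (cong₂ (λ U V → permanent entry U (oddCols C) ∧ permanent entry V (evenCols C))
        (trans (cong₂ _++_ (filterᵇ-all inOddCols (kEvens-inOddCols a)) (filterᵇ-none inOddCols (All.map proj₁ evenR)))
               (++-identityʳ (kEvens a)))
        (cong₂ _++_ (filterᵇ-none (not ∘ inOddCols) (All.map (cong not) (kEvens-inOddCols a)))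
                    (filterᵇ-all (not ∘ inOddCols) (All.map (cong not ∘ proj₁) evenR))))

jBordered-double : ∀ p → jBordered (p + p) ≡ jMinorSum p ∧ jHankel p
jBordered-double p =
  trans (permanent-↭ entry (↭-map⁺ jRow⁺ (upTo-double+1-↭ p)) (withExtra (upTo (p + p))))
    (trans (permanent-jRows⁺-byParity (suc p) p (upTo (p + p)))
      (trans (cong₂ _xor_
                (cong₂ _∧_ (trans (cong (λ U → xorSum (λ (_ , R) → permanent entry R U) (select (kEvens (suc p)))) odds)
                                  (kEvens-minorSum p))
                           (trans (cong (permanent entry (kOdds p)) evens) (permanent-kRows-odd×even (upTo p) (upTo p))))
                (cong (_∧ xorSum (λ (_ , R) → permanent entry R (evenCols (upTo (p + p)))) (select (kOdds p)))
                  (trans (cong (permanent entry (kEvens (suc p))) odds) (kEvens-too-long p))))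
        (xor-identityʳ _)))
  where
  odds : oddCols (upTo (p + p)) ≡ map col (oddsTo p)
  odds = cong (map col) (odds-upTo-double p)
  evens : evenCols (upTo (p + p)) ≡ map col (evensTo p)
  evens = cong (map col) (evens-upTo-double p)

jBordered-double+1 : ∀ p → jBordered (suc (p + p)) ≡ jMinorSum p ∧ jHankel (suc p)
jBordered-double+1 p =
  trans (permanent-↭ entry (↭-map⁺ jRow⁺ rows) (withExtra (upTo (suc (p + p)))))
    (trans (permanent-jRows⁺-byParity (suc p) (suc p) (upTo (suc (p + p))))
      (trans (cong₂ _xor_
                (cong₂ _∧_ (trans (cong (λ U → xorSum (λ (_ , R) → permanent entry R U) (select (kEvens (suc p)))) odds)
                                  (kEvens-minorSum p))
                           (trans (cong (permanent entry (kOdds (suc p))) evens)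
                                  (permanent-kRows-odd×even (upTo (suc p)) (upTo (suc p)))))
                (cong (_∧ xorSum (λ (_ , R) → permanent entry R (evenCols (upTo (suc (p + p))))) (select (kOdds (suc p))))
                  (trans (cong (permanent entry (kEvens (suc p))) odds) (kEvens-too-long p))))
        (xor-identityʳ _)))
  where
  rows : upTo (suc (suc (p + p))) ↭ evensTo (suc p) ++ oddsTo (suc p)
  rows = subst (λ n → upTo n ↭ evensTo (suc p) ++ oddsTo (suc p)) (+-suc (suc p) p) (upTo-double-↭ (suc p))
  odds : oddCols (upTo (suc (p + p))) ≡ map col (oddsTo p)
  odds = cong (map col) (odds-upTo-double+1 p)
  evens : evenCols (upTo (suc (p + p))) ≡ map col (evensTo (suc p))
  evens = cong (map col) (evens-upTo-double+1 p)

-- The two recurrences halve the size, but jHankel and jMinorSum feed each other, so they are proved together.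
jHankel-jMinorSum-true : ∀ q → jHankel q ≡ true × jMinorSum q ≡ true
jHankel-jMinorSum-true = <-rec _ λ q ih → go q (parityView q) ih
  where
  both : ∀ {a b} → a ≡ true → b ≡ true → a ∧ b ≡ true
  both refl refl = refl
  go : ∀ q → ParityView q → (∀ {q′} → q′ < q → jHankel q′ ≡ true × jMinorSum q′ ≡ true) →
       jHankel q ≡ true × jMinorSum q ≡ true
  go _ (even zero)    ih = refl , refl
  go _ (even (suc p)) ih =
    trans (jHankel-double (suc p)) (proj₁ (ih half<)) ,
    trans (sym (jBordered≡jMinorSum (suc p + suc p)))
      (trans (jBordered-double (suc p)) (both (proj₂ (ih half<)) (proj₁ (ih half<))))
    where
    half< : suc p < suc p + suc p
    half< rewrite +-suc (suc p) p = s≤s (s≤s (m≤m+n p p))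
  go _ (odd p) ih = hankel , minorSum
    where
    p< : p < suc (p + p)
    p< = s≤s (m≤m+n p p)
    hankel : jHankel (suc (p + p)) ≡ true
    hankel = trans (jHankel-double+1 p) (proj₂ (ih p<))
    hankel-suc : ∀ {p} → jHankel (suc (p + p)) ≡ true →
                 (∀ {q′} → q′ < suc (p + p) → jHankel q′ ≡ true × jMinorSum q′ ≡ true) →
                 jHankel (suc p) ≡ true
    hankel-suc {zero}   h ih = h
    hankel-suc {suc p′} h ih = proj₁ (ih (s≤s (s≤s (subst (suc p′ ≤_) (sym (+-suc p′ p′)) (s≤s (m≤m+n p′ p′))))))
    minorSum : jMinorSum (suc (p + p)) ≡ true
    minorSum = trans (sym (jBordered≡jMinorSum (suc (p + p))))
                 (trans (jBordered-double+1 p) (both (proj₂ (ih p<)) (hankel-suc {p} hankel ih)))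

kHankel : ℕ → Bool
kHankel m = permanent kEntry (upTo m) (upTo m)

jHankel-true : ∀ q → jHankel q ≡ true
jHankel-true q = proj₁ (jHankel-jMinorSum-true q)

jMinorSum-true : ∀ q → jMinorSum q ≡ true
jMinorSum-true q = proj₂ (jHankel-jMinorSum-true q)

kHankel-byParity : ∀ m → kHankel m ≡
  permanent entry (map kRow (filterᵇ isEven (upTo m))) (oddCols (upTo m)) ∧
  permanent entry (map kRow (filterᵇ (not ∘ isEven) (upTo m))) (evenCols (upTo m))
kHankel-byParity m =
  trans (sym (permanent-kRows (upTo m) (upTo m)))
    (trans (permanent-parityBlocks (kRows-paritySupported (upTo m)) (upTo m))
      (cong₂ (λ U V → permanent entry U (oddCols (upTo m)) ∧ permanent entry V (evenCols (upTo m)))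
        (filterᵇ-map inOddCols kRow (upTo m)) (filterᵇ-map (not ∘ inOddCols) kRow (upTo m))))

kHankel-isEven : ∀ m → kHankel m ≡ isEven m
kHankel-isEven m = go m (parityView m)
  where
  go : ∀ m → ParityView m → kHankel m ≡ isEven m
  go _ (even p) =
    trans (kHankel-byParity (p + p))
      (trans (cong₂ (λ E O → permanent entry (map kRow E) (map col O) ∧ permanent entry (map kRow O) (map col E))
                    (evens-upTo-double p) (odds-upTo-double p))
        (trans (cong₂ _∧_ (trans (permanent-kRows-even×odd (upTo p) (upTo p)) (jHankel-true p))
                          (trans (permanent-kRows-odd×even (upTo p) (upTo p)) (jHankel-true p)))
          (sym (isEven-double p))))
  go _ (odd p) =
    trans (kHankel-byParity (suc (p + p)))
      (trans (cong₂ (λ E O → permanent entry (map kRow E) (map col O) ∧ permanent entry (map kRow O) (map col E))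
                    (evens-upTo-double+1 p) (odds-upTo-double+1 p))
        (trans (cong (_∧ permanent entry (kOdds p) (map col (evensTo (suc p))))
                 (kEvens-too-long p))
          (sym (cong not (isEven-double p)))))

private
  kRows-noExtra : ∀ I → All NoExtra (map kRow I)
  kRows-noExtra I = map⁺ (universal (λ _ → refl) I)

  kRows-kHankel : ∀ n → permanent entry (map kRow (upTo n)) (map col (upTo n)) ≡ kHankel n
  kRows-kHankel n = permanent-kRows (upTo n) (upTo n)

  -- A row of ones⁺ in front absorbs every other row that is ones⁺ plus an extra-free row;
  -- then only its extraUnit part survives.
  ones⁺-absorbs : (f g : ℕ → Row) → (∀ i → f i ≐ ones⁺ ⊕ g i) → (∀ i → NoExtra (g i)) → ∀ n →
    permanent entry (map f (upTo n) ++ [ ones⁺ ]) (withExtra (upTo n)) ≡ permanent entry (map g (upTo n)) (map col (upTo n))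
  ones⁺-absorbs f g e ng n =
    trans (permanent-∷ʳ entry ones⁺ (map f (upTo n)) (withExtra (upTo n)))
      (trans (permanent-offset-absorbed entry (offset-map ones⁺ f g e (upTo n)) [] [] (withExtra (upTo n)))
        (trans (permanent-linear-head entry ones⁺ extraUnit ones ones⁺≐extraUnit⊕ones (map g (upTo n)) (withExtra (upTo n)))
          (trans (cong₂ _xor_ (permanent-extraUnit∷ noExtra (upTo n)) (permanent-noExtra (_∷_ {x = ones} refl noExtra) (upTo n)))
            (xor-identityʳ _))))
    where
    noExtra : All NoExtra (map g (upTo n))
    noExtra = map⁺ (universal ng (upTo n))

jRows⁺-ones⁺ : ∀ n → permanent entry (map jRow⁺ (upTo n) ++ [ ones⁺ ]) (withExtra (upTo n)) ≡ kHankel n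
jRows⁺-ones⁺ n = trans (ones⁺-absorbs jRow⁺ kRow jRow⁺≐ones⁺⊕kRow (λ _ → refl) n) (kRows-kHankel n)

kRows⁺-ones⁺ : ∀ n → permanent entry (map kRow⁺ (upTo n) ++ [ ones⁺ ]) (withExtra (upTo n)) ≡ true
kRows⁺-ones⁺ n =
  trans (ones⁺-absorbs kRow⁺ jRow kRow⁺≐ones⁺⊕jRow (λ _ → refl) n)
    (trans (permanent-jRows (upTo n) (upTo n)) (jHankel-true n))

kRows⁺-extraUnit : ∀ n → permanent entry (map kRow⁺ (upTo n) ++ [ extraUnit ]) (withExtra (upTo n)) ≡ kHankel n
kRows⁺-extraUnit n =
  trans (permanent-∷ʳ entry extraUnit (map kRow⁺ (upTo n)) (withExtra (upTo n)))
    (trans (permanent-offset-absorbed entry (offset-map extraUnit kRow⁺ kRow kRow⁺≐extraUnit⊕kRow (upTo n)) [] [] (withExtra (upTo n)))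
      (trans (permanent-extraUnit∷ (kRows-noExtra (upTo n)) (upTo n)) (kRows-kHankel n)))

-- Both bordered matrices expand along the extra column to the same sum of K-minors.
kRows⁺-bordered : ∀ n → permanent entry (map kRow⁺ (upTo (suc n))) (withExtra (upTo n)) ≡ true
kRows⁺-bordered n =
  trans (permanent-extraUnit-offset kRow⁺ kRow kRow⁺≐extraUnit⊕kRow (λ _ → refl) (upTo (suc n)) (upTo n))
    (trans (sym (permanent-ones⁺-offset jRow⁺ kRow jRow⁺≐ones⁺⊕kRow (λ _ → refl) (upTo (suc n)) (upTo n)))
      (trans (jBordered≡jMinorSum n) (jMinorSum-true n)))

kRows⁺-kRow : ∀ n → permanent entry (map kRow⁺ (upTo n) ++ [ kRow n ]) (withExtra (upTo n)) ≡ not (kHankel n)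
kRows⁺-kRow n =
  trans (permanent-linear entry (kRow n) (kRow⁺ n) extraUnit split (map kRow⁺ (upTo n)) [] (withExtra (upTo n)))
    (cong₂ _xor_ (trans (cong (λ L → permanent entry L (withExtra (upTo n))) (sym (map-upTo-suc kRow⁺ n))) (kRows⁺-bordered n))
                 (kRows⁺-extraUnit n))
  where
  split : kRow n ≐ kRow⁺ n ⊕ extraUnit
  split (col c) = sym (xor-identityʳ _)
  split extra   = refl

kRows⁺-ones : ∀ n → permanent entry (map kRow⁺ (upTo n) ++ [ ones ]) (withExtra (upTo n)) ≡ not (kHankel n)
kRows⁺-ones n =
  trans (permanent-linear entry ones ones⁺ extraUnit split (map kRow⁺ (upTo n)) [] (withExtra (upTo n)))
    (cong₂ _xor_ (kRows⁺-ones⁺ n) (kRows⁺-extraUnit n))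
  where
  split : ones ≐ ones⁺ ⊕ extraUnit
  split (col c) = refl
  split extra   = refl

-- Counting permutations

module _ {X : Set} (_≟_ : DecidableEquality X) where

  without : (X → Bool) → X → X → Bool
  without S x y = S y ∧ not (does (x ≟ y))

  without-self : ∀ S x → without S x x ≡ false
  without-self S x rewrite dec-true (x ≟ x) refl = ∧-zeroʳ (S x)

  without-other : ∀ S {x y} → ¬ x ≡ y → without S x y ≡ S y
  without-other S {x} {y} x≢y rewrite dec-false (x ≟ y) x≢y with S y
  ... | true  = refl
  ... | false = refl

  private
    filterᵇ-without-fresh : ∀ S {x L} → All (x ≢_) L → filterᵇ (without S x) L ≡ filterᵇ S L
    filterᵇ-without-fresh S []                       = refl
    filterᵇ-without-fresh S {x} {y ∷ L} (x≢y ∷ x∉L) rewrite without-other S x≢y with S y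
    ... | true  = cong (y ∷_) (filterᵇ-without-fresh S x∉L)
    ... | false = filterᵇ-without-fresh S x∉L

  xorSum-choose : (S : X → Bool) (G : X → List X → Bool) → ∀ {L} → Unique L →
    xorSum (λ x → S x ∧ G x (filterᵇ (without S x) L)) L ≡ xorSum (λ (c , C) → G c C) (select (filterᵇ S L))
  xorSum-choose S G {[]}    []          = refl
  xorSum-choose S G {y ∷ L} (y∉L ∷ uL) = go (S y) refl
    where
    rest : ∀ {b} → S y ≡ b → ∀ x → y ≢ x →
           filterᵇ (without S x) (y ∷ L) ≡ (if b then y ∷ filterᵇ (without S x) L else filterᵇ (without S x) L)
    rest {true}  e x y≢x = filterᵇ-accept (without S x) (trans (without-other S (y≢x ∘ sym)) e)
    rest {false} e x y≢x = filterᵇ-reject (without S x) (trans (without-other S (y≢x ∘ sym)) e)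
    go : ∀ b → S y ≡ b →
      xorSum (λ x → S x ∧ G x (filterᵇ (without S x) (y ∷ L))) (y ∷ L) ≡ xorSum (λ (c , C) → G c C) (select (filterᵇ S (y ∷ L)))
    go true e =
      trans (cong₂ _xor_
               (trans (cong (S y ∧_) (cong (G y) (trans (filterᵇ-reject (without S y) (without-self S y)) (filterᵇ-without-fresh S y∉L))))
                      (cong (_∧ G y (filterᵇ S L)) e))
               (trans (xorSum-cong-All (λ x y≢x → cong (λ C → S x ∧ G x C) (rest e x y≢x)) y∉L)
                      (trans (xorSum-choose S (λ c C → G c (y ∷ C)) uL) (sym (xorSum-map _ _ (select (filterᵇ S L)))))))
        (cong (λ C → xorSum (λ (c , C′) → G c C′) (select C)) (sym (filterᵇ-accept S e)))
    go false e =
      trans (cong₂ _xor_ (cong (_∧ G y (filterᵇ (without S y) (y ∷ L))) e)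
               (trans (xorSum-cong-All (λ x y≢x → cong (λ C → S x ∧ G x C) (rest e x y≢x)) y∉L) (xorSum-choose S G uL)))
        (cong (λ C → xorSum (λ (c , C′) → G c C′) (select C)) (sym (filterᵇ-reject S e)))

  length-without : ∀ S {x L} → Unique L → x ∈ L → S x ≡ true → suc (length (filterᵇ (without S x) L)) ≡ length (filterᵇ S L)
  length-without S {x} {x ∷ L} (x∉L ∷ _) (here refl) e
    rewrite filterᵇ-accept S {L = L} e | filterᵇ-reject (without S x) {L = L} (without-self S x) | filterᵇ-without-fresh S x∉L = refl
  length-without S {x} {y ∷ L} (y∉L ∷ uL) (there x∈L) e with x ≟ y
  ... | yes refl = contradiction x∈L (All¬⇒¬Any y∉L)
  ... | no x≢y with S y
  ... | true  = cong suc (length-without S uL x∈L e)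
  ... | false = length-without S uL x∈L e

module _ {m : ℕ} where

  private
    without′ : (Fin m → Bool) → Fin m → Fin m → Bool
    without′ = without Fin._≟_

  fits : ∀ {k} → (Fin m → Bool) → Vec (Fin m → Bool) k → Vec (Fin m) k → Bool
  fits S []       []      = true
  fits S (r ∷ rs) (x ∷ w) = S x ∧ (r x ∧ fits (without′ S x) rs w)

  fits-sound : ∀ {k} S (rs : Vec (Fin m → Bool) k) w → fits S rs w ≡ true →
    All (λ y → S y ≡ true) (toList w) × Unique (toList w) × (∀ i → lookup rs i (lookup w i) ≡ true)
  fits-sound S []       []      h = [] , [] , λ ()
  fits-sound S (r ∷ rs) (x ∷ w) h with ∧≡true h
  ... | Sx , h′ with ∧≡true h′
  ... | rx , h″ with fits-sound (without′ S x) rs w h″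
  ... | avail , unique , rows =
    (Sx ∷ All.map (proj₁ ∘ ∧≡true) avail) , (All.map fresh avail ∷ unique) , λ { Fin.zero → rx ; (Fin.suc i) → rows i }
    where
    fresh : ∀ {y} → without′ S x y ≡ true → x ≢ y
    fresh h refl = contradiction (trans (sym h) (without-self Fin._≟_ S x)) λ ()

  fits-complete : ∀ {k} S (rs : Vec (Fin m → Bool) k) w →
    All (λ y → S y ≡ true) (toList w) → Unique (toList w) → (∀ i → lookup rs i (lookup w i) ≡ true) → fits S rs w ≡ true
  fits-complete S []       []      _          _              _    = refl
  fits-complete S (r ∷ rs) (x ∷ w) (Sx ∷ avail) (x∉w ∷ unique) rows
    rewrite Sx | rows Fin.zero =
    fits-complete (without′ S x) rs w (All.zipWith (λ (Sy , x≢y) → trans (without-other Fin._≟_ S x≢y) Sy) (avail , x∉w))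
      unique (λ i → rows (Fin.suc i))

  xorSum-fits : ∀ k (rs : Vec (Fin m → Bool) k) (S : Fin m → Bool) → length (filterᵇ S (allFin m)) ≡ k →
    xorSum (fits S rs) (allVecs m k) ≡ permanent (λ r x → r x) (toList rs) (filterᵇ S (allFin m))
  xorSum-fits zero    []       S e with filterᵇ S (allFin m)
  ... | [] = refl
  xorSum-fits (suc k) (r ∷ rs) S e =
    trans (xorSum-concatMap (fits S (r ∷ rs)) (λ x → map (x ∷_) (allVecs m k)) (allFin m))
      (trans (xorSum-cong first (allFin m))
        (xorSum-choose Fin._≟_ S (λ c C → r c ∧ permanent (λ r x → r x) (toList rs) C) (allFin⁺ m)))
    where
    first : ∀ x → xorSum (fits S (r ∷ rs)) (map (x ∷_) (allVecs m k)) ≡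
                  S x ∧ (r x ∧ permanent (λ r x → r x) (toList rs) (filterᵇ (without′ S x) (allFin m)))
    first x =
      trans (xorSum-map (x ∷_) (fits S (r ∷ rs)) (allVecs m k))
        (trans (sym (∧-distribˡ-xorSum (S x) _ (allVecs m k)))
          (∧-cong-when (S x) λ Sx →
            trans (sym (∧-distribˡ-xorSum (r x) _ (allVecs m k)))
              (cong (r x ∧_) (xorSum-fits k rs (without′ S x)
                (suc-injective (trans (length-without Fin._≟_ S (allFin⁺ m) (∈-allFin x) Sx) e))))))

countᵇ-CountIs : {X : Set} (P : X → Set) (b : X → Bool) → (∀ x → P x → b x ≡ true) → (∀ x → b x ≡ true → P x) →
                 ∀ xs → CountIs P xs (length (filterᵇ b xs))
countᵇ-CountIs P b sound complete []       = c-nil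
countᵇ-CountIs P b sound complete (x ∷ xs) with b x in e
... | true  = c-yes (complete x e) (countᵇ-CountIs P b sound complete xs)
... | false = c-no (λ px → contradiction (trans (sym (sound x px)) e) λ ()) (countᵇ-CountIs P b sound complete xs)

isEven-countᵇ : {X : Set} (b : X → Bool) → ∀ xs → not (isEven (length (filterᵇ b xs))) ≡ xorSum b xs
isEven-countᵇ b []       = refl
isEven-countᵇ b (x ∷ xs) with b x
... | true  = cong not (isEven-countᵇ b xs)
... | false = isEven-countᵇ b xs

%2-isEven : ∀ n → n % 2 ≡ (if isEven n then 0 else 1)
%2-isEven zero          = refl
%2-isEven (suc zero)    = refl
%2-isEven (suc (suc n)) =
  trans (cong (_% 2) (+-comm 2 n))
    (trans ([m+n]%n≡m%n n 2) (trans (%2-isEven n) (cong (λ b → if b then 0 else 1) (sym (not-involutive (isEven n))))))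

isEven⇒≡₂ : ∀ a b → isEven a ≡ isEven b → a ≡₂ b
isEven⇒≡₂ a b e = trans (%2-isEven a) (trans (cong (λ b → if b then 0 else 1) e) (sym (%2-isEven b)))

Indicator : SubsetN → (ℕ → Bool) → Set
Indicator P b = (∀ x → P x → b x ≡ true) × (∀ x → b x ≡ true → P x)

Jset-indicator : Indicator Jset isJ
Jset-indicator = Jset⇒isJ , isJ⇒Jset

Kset-indicator : Indicator Kset isK
Kset-indicator = Kset⇒isK , isK⇒Kset

Nset-indicator : Indicator Nset (λ _ → true)
Nset-indicator = (λ _ _ → refl) , (λ _ _ → _)

-- The Bool analogue of Defs.region for m = n + 1, on ℕ indices.
cornerᵇ : ℕ → (a b c d : ℕ → Bool) → ℕ → ℕ → ℕ → Bool
cornerᵇ n a b c d i j with i ℕ.≟ n | j ℕ.≟ n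
... | no  _ | no  _ = a
... | no  _ | yes _ = b
... | yes _ | no  _ = c
... | yes _ | yes _ = d

cornerMatrix : ℕ → (a b c d : ℕ → Bool) → ℕ → ℕ → Bool
cornerMatrix n a b c d i j = cornerᵇ n a b c d i j (i + j)

module _ {A B C D : SubsetN} {a b c d : ℕ → Bool}
         (iA : Indicator A a) (iB : Indicator B b) (iC : Indicator C c) (iD : Indicator D d) (n : ℕ) where

  private
    region-indicator : ∀ (i j : Fin (suc n)) → Indicator (region (suc n) A B C D i j) (cornerᵇ n a b c d (toℕ i) (toℕ j))
    region-indicator i j with toℕ i ℕ.≟ n | toℕ j ℕ.≟ n
    ... | no  _ | no  _ = iA
    ... | no  _ | yes _ = iB
    ... | yes _ | no  _ = iC
    ... | yes _ | yes _ = iD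

    rowFn : Fin (suc n) → Fin (suc n) → Bool
    rowFn i j = cornerMatrix n a b c d (toℕ i) (toℕ j)

    rows : Vec (Fin (suc n) → Bool) (suc n)
    rows = tabulate rowFn

    apply : (Fin (suc n) → Bool) → Fin (suc n) → Bool
    apply r x = r x

    admissible? : Vec (Fin (suc n)) (suc n) → Bool
    admissible? = fits (λ _ → true) rows

    row-lookup : ∀ σ i → lookup rows i (lookup σ i) ≡ cornerMatrix n a b c d (toℕ i) (toℕ (lookup σ i))
    row-lookup σ i = cong (λ f → f (lookup σ i)) (lookup∘tabulate rowFn i)

    admissible?-sound : ∀ σ → admissible? σ ≡ true → Admissible (suc n) A B C D σ
    admissible?-sound σ h with fits-sound (λ _ → true) rows σ h
    ... | _ , unique , allowed = unique , λ i → proj₂ (region-indicator i (lookup σ i)) _ (trans (sym (row-lookup σ i)) (allowed i))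

    admissible?-complete : ∀ σ → Admissible (suc n) A B C D σ → admissible? σ ≡ true
    admissible?-complete σ (unique , allowed) =
      fits-complete (λ _ → true) rows σ (universal (λ _ → refl) (toList σ)) unique
        (λ i → trans (row-lookup σ i) (proj₁ (region-indicator i (lookup σ i)) _ (allowed i)))

    count : ℕ
    count = length (filterᵇ admissible? (allVecs (suc n) (suc n)))

    allFin-available : filterᵇ (λ _ → true) (allFin (suc n)) ≡ allFin (suc n)
    allFin-available = filterᵇ-all (λ _ → true) (universal (λ _ → refl) (allFin (suc n)))

    toList-tabulate : ∀ {k} {X : Set} (f : Fin k → X) → toList (tabulate f) ≡ List.tabulate f
    toList-tabulate {zero}  f = refl
    toList-tabulate {suc k} f = cong (f Fin.zero ∷_) (toList-tabulate (f ∘ Fin.suc))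

    map-toℕ-allFin : ∀ k → map toℕ (allFin k) ≡ upTo k
    map-toℕ-allFin k = trans (map-tabulate id toℕ) (tabulate-toℕ id k)
      where
      tabulate-toℕ : (f : ℕ → ℕ) → ∀ k → List.tabulate {n = k} (f ∘ toℕ) ≡ applyUpTo f k
      tabulate-toℕ f zero    = refl
      tabulate-toℕ f (suc k) = cong (f 0 ∷_) (tabulate-toℕ (f ∘ suc) k)

    count-parity : not (isEven count) ≡ permanent (cornerMatrix n a b c d) (upTo (suc n)) (upTo (suc n))
    count-parity =
      trans (isEven-countᵇ admissible? (allVecs (suc n) (suc n)))
        (trans (xorSum-fits (suc n) rows (λ _ → true) (trans (cong length (allFin-available)) (length-tabulate id)))
          (trans (cong₂ (permanent apply) (toList-tabulate rowFn) (allFin-available))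
            (trans (cong (λ R → permanent apply R (allFin (suc n))) (sym (map-tabulate id rowFn)))
              (trans (permanent-map-rows apply rowFn (allFin (suc n)) (allFin (suc n)))
                (trans (sym (permanent-map-cols (λ i → cornerMatrix n a b c d (toℕ i)) toℕ (allFin (suc n)) (allFin (suc n))))
                  (trans (sym (permanent-map-rows (cornerMatrix n a b c d) toℕ (allFin (suc n)) (map toℕ (allFin (suc n)))))
                    (cong₂ (permanent (cornerMatrix n a b c d)) (map-toℕ-allFin (suc n)) (map-toℕ-allFin (suc n)))))))))

  countParity-from-permanent : ∀ r → permanent (cornerMatrix n a b c d) (upTo (suc n)) (upTo (suc n)) ≡ not (isEven r) →
                               CountParity (suc n) A B C D r
  countParity-from-permanent r h =
    count ,
    countᵇ-CountIs (Admissible (suc n) A B C D) admissible? admissible?-complete admissible?-sound (allVecs (suc n) (suc n)) ,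
    isEven⇒≡₂ count r (not-injective (trans count-parity h))

-- The six matrices

module _ (n : ℕ) where

  cornerMatrix-uniform : (h : ℕ → Bool) → ∀ i j → cornerMatrix n h h h h i j ≡ h (i + j)
  cornerMatrix-uniform h i j with i ℕ.≟ n | j ℕ.≟ n
  ... | no  _ | no  _ = refl
  ... | no  _ | yes _ = refl
  ... | yes _ | no  _ = refl
  ... | yes _ | yes _ = refl

  -- Index n becomes the extra column and the row ℓ; the other indices keep their Hankel rows and columns.
  cornerMatrix-withExtra : ∀ {a b c d} (f : ℕ → Row) (ℓ : Row) →
    (∀ i j → a (i + j) ≡ entry (f i) (col j)) → (∀ i → b (i + n) ≡ entry (f i) extra) →
    (∀ j → c (n + j) ≡ entry ℓ (col j)) → d (n + n) ≡ entry ℓ extra →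
    permanent (cornerMatrix n a b c d) (upTo (suc n)) (upTo (suc n)) ≡
    permanent entry (map f (upTo n) ++ [ ℓ ]) (withExtra (upTo n))
  cornerMatrix-withExtra {a} {b} {c} {d} f ℓ ha hb hc hd =
    trans (permanent-cong pointwise (upTo (suc n)) (upTo (suc n)))
      (trans (sym (permanent-map-cols (λ i → entry (rowOf i)) colOf (upTo (suc n)) (upTo (suc n))))
        (trans (sym (permanent-map-rows entry rowOf (upTo (suc n)) (map colOf (upTo (suc n)))))
          (cong₂ (permanent entry) (map-replaceLast n f ℓ) (map-replaceLast n col extra))))
    where
    rowOf : ℕ → Row
    rowOf = replaceLast n f ℓ
    colOf : ℕ → Col
    colOf = replaceLast n col extra
    pointwise : ∀ i j → cornerMatrix n a b c d i j ≡ entry (rowOf i) (colOf j)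
    pointwise i j with i ℕ.≟ n | j ℕ.≟ n
    ... | no  _    | no  _    = ha i j
    ... | no  _    | yes refl = hb i
    ... | yes refl | no  _    = hc j
    ... | yes refl | yes refl = hd

parity-+2 : ∀ n → not (isEven (suc n + 1)) ≡ not (isEven n)
parity-+2 n = trans (not-involutive _) (cong isEven (+-comm n 1))

theoremD : (m : ℕ) → 1 ≤ m →
    CountParity m Jset Jset Jset Jset 1
    × CountParity m Jset Nset Jset Nset 1
    × CountParity m Jset Nset Nset Nset m
    × CountParity m Kset Kset Kset Kset (m + 1)
    × CountParity m Kset Nset Kset Kset (m + 1)
    × CountParity m Kset Nset Nset Kset (m + 1)
theoremD (suc n) (s≤s z≤n) =
  countParity-from-permanent Jset-indicator Jset-indicator Jset-indicator Jset-indicator n 1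
    (trans (permanent-cong (cornerMatrix-uniform n isJ) (upTo (suc n)) (upTo (suc n))) (jHankel-true (suc n))) ,
  countParity-from-permanent Jset-indicator Nset-indicator Jset-indicator Nset-indicator n 1
    (trans (cornerMatrix-withExtra n jRow⁺ (jRow⁺ n) (λ _ _ → refl) (λ _ → refl) (λ _ → refl) refl)
      (trans (cong (λ R → permanent entry R (withExtra (upTo n))) (sym (map-upTo-suc jRow⁺ n)))
        (trans (jBordered≡jMinorSum n) (jMinorSum-true n)))) ,
  countParity-from-permanent Jset-indicator Nset-indicator Nset-indicator Nset-indicator n (suc n)
    (trans (cornerMatrix-withExtra n jRow⁺ ones⁺ (λ _ _ → refl) (λ _ → refl) (λ _ → refl) refl)
      (trans (jRows⁺-ones⁺ n) (trans (kHankel-isEven n) (sym (not-involutive (isEven n)))))) ,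
  countParity-from-permanent Kset-indicator Kset-indicator Kset-indicator Kset-indicator n (suc n + 1)
    (trans (permanent-cong (cornerMatrix-uniform n isK) (upTo (suc n)) (upTo (suc n)))
      (trans (kHankel-isEven (suc n)) (sym (parity-+2 n)))) ,
  countParity-from-permanent Kset-indicator Nset-indicator Kset-indicator Kset-indicator n (suc n + 1)
    (trans (cornerMatrix-withExtra n kRow⁺ (kRow n) (λ _ _ → refl) (λ _ → refl) (λ _ → refl) (isK-double n))
      (trans (kRows⁺-kRow n) (trans (cong not (kHankel-isEven n)) (sym (parity-+2 n))))) ,
  countParity-from-permanent Kset-indicator Nset-indicator Nset-indicator Kset-indicator n (suc n + 1)
    (trans (cornerMatrix-withExtra n kRow⁺ ones (λ _ _ → refl) (λ _ → refl) (λ _ → refl) (isK-double n))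
      (trans (kRows⁺-ones n) (trans (cong not (kHankel-isEven n)) (sym (parity-+2 n)))))
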